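{- Let $n\ge1$ and let $Q_n$ be the set of vertices of the bidirectional ballot polytope $\mathcal{P}_n\subset[0,1]^{2n-1}$. For $v=[v_1,\dots,v_{2n-1}]\in Q_n$ let $\alpha(v)=[1,0,v_1,\dots,v_{2n-1},0,1]\in\{0,1\}^{2n+3}$, let $\lambda_i=(-1)^{i-1}(2\alpha(v)_i-1)\in\{\pm1\}$ for $1\le i\le 2n+3$, and let $b(v)=b_1\cdots b_{2n+3}$ be the binary sequence with $b_i=1$ if $\lambda_i=1$ and $b_i=0$ if $\lambda_i=-1$ (equivalently, the lattice path with steps $(1,\lambda_i)$ is the graph of the piecewise linear function $f_\lambda$ with $f_\lambda(0)=0$ and slope $\lambda_i$ on $(i-1,i)$). Then $v\mapsto b(v)$ is a bijection from $Q_n$ onto the set of bidirectional ballot sequences of length $2n+3$.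
   Context: A bidirectional ballot sequence is a finite 0-1 sequence such that every nonempty prefix and every nonempty suffix contains strictly more ones than zeros. Let $m=2n-1$. The left ballot vectors are $L_n=\{w_1,\dots,w_{n-1}\}\subset\mathbb{R}^m$, where $w_k$ consists of $k$ copies of the pair $(1,-1)$ followed by $m-2k$ zeros; the right ballot vectors are $R_n=\{u_1,\dots,u_{n-1}\}$, where $u_k$ consists of $m-2k$ zeros followed by $k$ copies of the pair $(-1,1)$; $V_n=L_n\cup R_n$. The bidirectional ballot polytope is $\mathcal{P}_n=\{x\in[0,1]^m: x\cdot w\ge0\ \forall w\in V_n\}$.
   Formalization: The polytope $\mathcal{P}_n$ and its vertices are taken in ℚ^m rather than $\mathbb{R}^m$, with extreme points tested against rational convex combinations of rational points. -}

module Defs where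

open import Data.Nat as ℕ using (ℕ; zero; suc; _∸_)
open import Data.Nat.Properties using () renaming (_<?_ to _<ℕ?_)
open import Data.Fin using (Fin; toℕ)
open import Data.Bool using (Bool; true; false; if_then_else_; not)
open import Data.List as List using (List; length; take; drop; filter)
open import Data.Vec as Vec using (Vec; []; _∷_; _++_; tabulate; lookup; zipWith; foldr; toList)
open import Data.Rational as ℚ using (ℚ; 0ℚ; 1ℚ; _+_; _*_; _-_; -_; _≤_; _<_)
open import Data.Rational.Properties using (_≟_)
open import Data.Product using (_×_)
open import Relation.Nullary using (does)
open import Relation.Binary.PropositionalEquality using (_≡_)

dim : ℕ → ℕ
dim n = 2 ℕ.* n ∸ 1

dot : ∀ {m} → Vec ℚ m → Vec ℚ m → ℚ
dot x y = foldr _ _+_ 0ℚ (zipWith _*_ x y)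

isEven : ℕ → Bool
isEven zero = true
isEven (suc j) = not (isEven j)

sgn : ℕ → ℚ
sgn j = if isEven j then 1ℚ else - 1ℚ

-- left ballot vector w_k ∈ ℚ^m : k copies of (1,-1) followed by m-2k zeros
-- (0-based coordinate i: (-1)^i if i < 2k, else 0)
wvec : (m k : ℕ) → Vec ℚ m
wvec m k = tabulate λ i → if does (toℕ i <ℕ? 2 ℕ.* k) then sgn (toℕ i) else 0ℚ

-- right ballot vector u_k ∈ ℚ^m : m-2k zeros followed by k copies of (-1,1)
-- (0-based coordinate i ≥ m-2k, j = i-(m-2k): -(-1)^j, else 0)
uvec : (m k : ℕ) → Vec ℚ m
uvec m k = tabulate λ i →
  if does (toℕ i <ℕ? m ∸ 2 ℕ.* k) then 0ℚ else - sgn (toℕ i ∸ (m ∸ 2 ℕ.* k))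

InPolytope : (n : ℕ) → Vec ℚ (dim n) → Set
InPolytope n x =
  (∀ (i : Fin (dim n)) → (0ℚ ≤ lookup x i) × (lookup x i ≤ 1ℚ)) ×
  (∀ (k : ℕ) → 1 ℕ.≤ k → k ℕ.≤ n ∸ 1 →
     (0ℚ ≤ dot x (wvec (dim n) k)) × (0ℚ ≤ dot x (uvec (dim n) k)))

convex : ∀ {m} → ℚ → Vec ℚ m → Vec ℚ m → Vec ℚ m
convex t y z = zipWith (λ a b → t * a + (1ℚ - t) * b) y z

IsVertex : (n : ℕ) → Vec ℚ (dim n) → Set
IsVertex n x =
  InPolytope n x ×
  (∀ (y z : Vec ℚ (dim n)) (t : ℚ) → InPolytope n y → InPolytope n z →
     0ℚ < t → t < 1ℚ → x ≡ convex t y z → y ≡ z)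

alpha : ∀ {m} → Vec ℚ m → Vec ℚ (4 ℕ.+ m)
alpha {m} v = Vec.cast eq (1ℚ ∷ 0ℚ ∷ (v ++ (0ℚ ∷ 1ℚ ∷ [])))
  where
  open import Data.Nat.Properties using (+-comm; +-suc)
  open import Relation.Binary.PropositionalEquality using (cong)
  eq : 2 ℕ.+ (m ℕ.+ 2) ≡ 4 ℕ.+ m
  eq = cong (λ r → 2 ℕ.+ r) (+-comm m 2)

-- λ_i = (-1)^{i-1} (2 α(v)_i - 1)   (1-based i; here 0-based index j = i-1)
lam : ∀ {m} → Vec ℚ m → Vec ℚ (4 ℕ.+ m)
lam v = tabulate λ j → sgn (toℕ j) * ((1ℚ + 1ℚ) * lookup (alpha v) j - 1ℚ)

bseq : ∀ {m} → Vec ℚ m → Vec Bool (4 ℕ.+ m)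
bseq v = Vec.map (λ l → does (l ≟ 1ℚ)) (lam v)

ones zeros : List Bool → ℕ
ones xs = length (filter (λ b → b Data.Bool.≟ true) xs)
zeros xs = length (filter (λ b → b Data.Bool.≟ false) xs)

IsBBS : List Bool → Set
IsBBS xs =
  (∀ j → 1 ℕ.≤ j → j ℕ.≤ length xs →
     zeros (take j xs) ℕ.< ones (take j xs)) ×
  (∀ j → j ℕ.< length xs →
     zeros (drop j xs) ℕ.< ones (drop j xs))

-- Let S_t = Σ_{i<t} (-1)^i x_i be the alternating partial sums (the path) of x ∈ ℚ^m, m = 2n - 1.
-- Then x ∈ P_n iff every step (-1)^t (S_{t+1} - S_t) lies in [0,1] and 0 ≤ S_t ≤ S_m for all t ≤ m.
-- Both conditions survive replacing S by g ∘ S for any monotone g : ℚ → ℚ with g 0 = 0 and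
-- g (1 + p) = 1 + g p.  Two such maps g⁺, g⁻ with g⁺ + g⁻ = 2·id, which agree only at integers,
-- exhibit every x ∈ P_n as the midpoint of two points of P_n; at a vertex the two coincide, so S is
-- integral and x is a 0-1 vector.  Conversely every 0-1 point of P_n is a vertex.  For a 0-1 vector v
-- with bits b, b(v) = 1 1 c 1 1 where c is b with every second bit flipped (starting from the second),
-- and the prefix heights (#1 − #0) of c are 2 S_t − (t mod 2); so the ballot conditions on 1 1 c 1 1 say
-- exactly that 0 ≤ S_t ≤ S_m for all t ≤ m, which is membership of v in P_n.

module Submission where

open import Defs
open import Data.Nat using (ℕ; _≤_)
open import Data.Bool using (Bool)
open import Data.Vec using (Vec; toList)
open import Data.Rational using (ℚ)
open import Data.Product using (_×_; ∃)
open import Relation.Binary.PropositionalEquality using (_≡_)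

open import Data.Bool using (true; false; not; T; if_then_else_)
open import Data.Bool.Properties using (not-involutive)
open import Data.Empty using (⊥-elim)
open import Data.Fin using (Fin; zero; suc; toℕ; fromℕ<)
open import Data.Fin.Properties using (toℕ-fromℕ<; toℕ<n)
open import Data.Integer as ℤ using (ℤ; 0ℤ; 1ℤ; -1ℤ)
import Data.Integer.Properties as ℤ
import Data.Integer.DivMod as ℤ
open import Data.Integer.Tactic.RingSolver using () renaming (ring to ℤ-ring)
open import Data.List as List using (List; []; _∷_; _++_; take; drop; length)
open import Data.List.Properties using (take++drop≡id; take-all; length-++; take-map; ++-assoc)
open import Data.Nat using (zero; suc)
import Data.Nat as ℕ
import Data.Nat.Properties as ℕ
open import Data.Nat.Coprimality using (1-coprimeTo) renaming (sym to coprime-sym)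
open import Data.Nat.Tactic.RingSolver using () renaming (ring to ℕ-ring)
open import Data.Product using (_,_; proj₁; proj₂)
import Data.Product as Product
open import Data.Rational
  using (mkℚ; *≤*; *<*; 0ℚ; 1ℚ; ½; _+_; _*_; _-_; -_; _<_; _⊓_; _⊔_; floor; ↧_; positive; nonNegative)
  renaming (_≤_ to _≤ℚ_)
open import Data.Rational.Properties
import Data.Rational.Unnormalised as ℚᵘ
import Data.Rational.Unnormalised.Properties as ℚᵘ
open import Data.Sum using (_⊎_; inj₁; inj₂)
open import Data.Vec as Vec using ([]; _∷_; _∷ʳ_; tabulate; lookup; zipWith)
open import Data.Vec.Properties
  using (tabulate∘lookup; tabulate-cong; lookup-map; lookup-zipWith; toList-map; length-toList; toList-∷ʳ; map-∷ʳ;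
         ∷ʳ-injectiveˡ; ∷-injectiveʳ)
open import Function using (_∘_)
open import Relation.Binary.Definitions using (tri<; tri≈; tri>)
open import Relation.Binary.PropositionalEquality using (refl; sym; cong; cong₂; subst; subst₂; trans; module ≡-Reasoning)
open import Relation.Nullary using (does; yes; no; contradiction)
open import Relation.Nullary.Decidable using (dec⇒maybe)
open import Tactic.RingSolver using (solve-∀)
import Tactic.RingSolver.Core.AlmostCommutativeRing as ACR

ℚ-ring : ACR.AlmostCommutativeRing _ _
ℚ-ring = ACR.fromCommutativeRing +-*-commutativeRing (λ x → dec⇒maybe (0ℚ ≟ x))

fromℤ : ℤ → ℚ
fromℤ k = mkℚ k 0 (coprime-sym (1-coprimeTo ℤ.∣ k ∣))

fromℤ-mono-≤ : ∀ {k l} → k ℤ.≤ l → fromℤ k ≤ℚ fromℤ l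
fromℤ-mono-≤ {k} {l} k≤l = *≤* (subst₂ ℤ._≤_ (sym (ℤ.*-identityʳ k)) (sym (ℤ.*-identityʳ l)) k≤l)

fromℤ-cancel-≤ : ∀ {k l} → fromℤ k ≤ℚ fromℤ l → k ℤ.≤ l
fromℤ-cancel-≤ {k} {l} (*≤* k≤l) = subst₂ ℤ._≤_ (ℤ.*-identityʳ k) (ℤ.*-identityʳ l) k≤l

fromℤ-cancel-< : ∀ {k l} → fromℤ k < fromℤ l → k ℤ.< l
fromℤ-cancel-< {k} {l} (*<* k<l) = subst₂ ℤ._<_ (ℤ.*-identityʳ k) (ℤ.*-identityʳ l) k<l

fromℤ-+ : ∀ k l → fromℤ (k ℤ.+ l) ≡ fromℤ k + fromℤ l
fromℤ-+ k l = toℚᵘ-injective (ℚᵘ.≃-trans (ℚᵘ.*≡* (cross-multiplied k l)) (ℚᵘ.≃-sym (toℚᵘ-homo-+ (fromℤ k) (fromℤ l))))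
  where
  cross-multiplied : ∀ k l → (k ℤ.+ l) ℤ.* ℤ.+ 1 ≡ (k ℤ.* ℤ.+ 1 ℤ.+ l ℤ.* ℤ.+ 1) ℤ.* ℤ.+ 1
  cross-multiplied = solve-∀ ℤ-ring

fromℤ-neg : ∀ k → fromℤ (ℤ.- k) ≡ - fromℤ k
fromℤ-neg (ℤ.+ zero) = refl
fromℤ-neg (ℤ.+ suc n) = refl
fromℤ-neg ℤ.-[1+ n ] = refl

fromℤ-minus : ∀ k l → fromℤ (k ℤ.- l) ≡ fromℤ k - fromℤ l
fromℤ-minus k l = trans (fromℤ-+ k (ℤ.- l)) (cong (fromℤ k +_) (fromℤ-neg l))

fromℤ-suc : ∀ k → fromℤ (ℤ.suc k) ≡ 1ℚ + fromℤ k
fromℤ-suc k = fromℤ-+ (ℤ.+ 1) k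

fromℤ-floor-≤ : ∀ p → fromℤ (floor p) ≤ℚ p
fromℤ-floor-≤ p@(mkℚ n d _) = *≤* (subst (floor p ℤ.* ↧ p ℤ.≤_) (sym (ℤ.*-identityʳ n)) (ℤ.[n/d]*d≤n n (↧ p)))

<-fromℤ-suc-floor : ∀ p → p < fromℤ (ℤ.suc (floor p))
<-fromℤ-suc-floor p@(mkℚ n d _) = *<* (subst₂ ℤ._<_ (sym (ℤ.*-identityʳ n))
  (cong (λ q → ℤ.suc q ℤ.* ↧ p) (sym (ℤ.div-pos-is-/ℕ n (suc d)))) (ℤ.n<s[n/ℕd]*d n (suc d)))

p≤q⇒0≤q-p : ∀ {p q} → p ≤ℚ q → 0ℚ ≤ℚ q - p
p≤q⇒0≤q-p {p} {q} p≤q = subst (_≤ℚ q - p) (+-inverseʳ p) (+-monoˡ-≤ (- p) p≤q)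

0≤q-p⇒p≤q : ∀ {p q} → 0ℚ ≤ℚ q - p → p ≤ℚ q
0≤q-p⇒p≤q {p} {q} 0≤q-p = subst₂ _≤ℚ_ (+-identityˡ p) (add-back q p) (+-monoˡ-≤ p 0≤q-p)
  where
  add-back : ∀ q p → q - p + p ≡ q
  add-back = solve-∀ ℚ-ring

p≤q⇒p-q≤0 : ∀ {p q} → p ≤ℚ q → p - q ≤ℚ 0ℚ
p≤q⇒p-q≤0 {p} {q} p≤q = subst (p - q ≤ℚ_) (+-inverseʳ q) (+-monoˡ-≤ (- q) p≤q)

+-cancelˡ-≡ : ∀ k {p q} → k + p ≡ k + q → p ≡ q
+-cancelˡ-≡ k {p} {q} eq = trans (cancel k p) (trans (cong (_- k) eq) (sym (cancel k q)))
  where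
  cancel : ∀ k p → p ≡ k + p - k
  cancel = solve-∀ ℚ-ring

<suc⇒≤ : ∀ {k l} → k ℤ.< ℤ.suc l → k ℤ.≤ l
<suc⇒≤ {k} {l} k<sl = subst (k ℤ.≤_) (ℤ.pred-suc l) (ℤ.i<j⇒i≤pred[j] k<sl)

floor-unique : ∀ {k p} → fromℤ k ≤ℚ p → p < fromℤ (ℤ.suc k) → floor p ≡ k
floor-unique {k} {p} k≤p p<k+1 = ℤ.≤-antisym
  (<suc⇒≤ (fromℤ-cancel-< (≤-<-trans (fromℤ-floor-≤ p) p<k+1)))
  (<suc⇒≤ (fromℤ-cancel-< (≤-<-trans k≤p (<-fromℤ-suc-floor p))))

floor-suc : ∀ p → floor (1ℚ + p) ≡ ℤ.suc (floor p)
floor-suc p = floor-unique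
  (subst (_≤ℚ 1ℚ + p) (sym (fromℤ-suc (floor p))) (+-monoʳ-≤ 1ℚ (fromℤ-floor-≤ p)))
  (subst (1ℚ + p <_) (sym (fromℤ-suc (ℤ.suc (floor p)))) (+-monoʳ-< 1ℚ (<-fromℤ-suc-floor p)))

⌊_⌋ℚ : ℚ → ℚ
⌊ p ⌋ℚ = fromℤ (floor p)

frac : ℚ → ℚ
frac p = p - ⌊ p ⌋ℚ

0≤frac : ∀ p → 0ℚ ≤ℚ frac p
0≤frac p = p≤q⇒0≤q-p (fromℤ-floor-≤ p)

frac<1 : ∀ p → frac p < 1ℚ
frac<1 p = begin-strict
  p - ⌊ p ⌋ℚ                   <⟨ +-monoˡ-< (- ⌊ p ⌋ℚ) (<-fromℤ-suc-floor p) ⟩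
  fromℤ (ℤ.suc (floor p)) - ⌊ p ⌋ℚ ≡⟨ cong (_- ⌊ p ⌋ℚ) (fromℤ-suc (floor p)) ⟩
  1ℚ + ⌊ p ⌋ℚ - ⌊ p ⌋ℚ           ≡⟨ cancel 1ℚ ⌊ p ⌋ℚ ⟩
  1ℚ                           ∎
  where
  open ≤-Reasoning
  cancel : ∀ a k → a + k - k ≡ a
  cancel = solve-∀ ℚ-ring

⌊suc⌋ℚ : ∀ p → ⌊ 1ℚ + p ⌋ℚ ≡ 1ℚ + ⌊ p ⌋ℚ
⌊suc⌋ℚ p = trans (cong fromℤ (floor-suc p)) (fromℤ-suc (floor p))

frac-suc : ∀ p → frac (1ℚ + p) ≡ frac p
frac-suc p = trans (cong (λ k → 1ℚ + p - k) (⌊suc⌋ℚ p)) (cancel p ⌊ p ⌋ℚ)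
  where
  cancel : ∀ p k → 1ℚ + p - (1ℚ + k) ≡ p - k
  cancel = solve-∀ ℚ-ring

p≡⌊p⌋+frac : ∀ p → p ≡ ⌊ p ⌋ℚ + frac p
p≡⌊p⌋+frac p = split p ⌊ p ⌋ℚ
  where
  split : ∀ p k → p ≡ k + (p - k)
  split = solve-∀ ℚ-ring

record IsMonotoneLift (g : ℚ → ℚ) : Set where
  field
    fix-0 : g 0ℚ ≡ 0ℚ
    mono  : ∀ {p q} → p ≤ℚ q → g p ≤ℚ g q
    shift : ∀ p → g (1ℚ + p) ≡ 1ℚ + g p

shiftExtension : (ℚ → ℚ) → ℚ → ℚ
shiftExtension h p = ⌊ p ⌋ℚ + h (frac p)

module _ {h : ℚ → ℚ} (h-mono : ∀ {p q} → p ≤ℚ q → h p ≤ℚ h q)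
         (h-0 : h 0ℚ ≡ 0ℚ) (h-1 : h 1ℚ ≡ 1ℚ) where

  shiftExtension-mono : ∀ {p q} → p ≤ℚ q → shiftExtension h p ≤ℚ shiftExtension h q
  shiftExtension-mono {p} {q} p≤q with ℤ.<-cmp (floor p) (floor q)
  ... | tri≈ _ ⌊p⌋≡⌊q⌋ _ = subst (λ k → k + h (p - k) ≤ℚ ⌊ q ⌋ℚ + h (frac q)) (cong fromℤ (sym ⌊p⌋≡⌊q⌋))
          (+-monoʳ-≤ ⌊ q ⌋ℚ (h-mono (+-monoˡ-≤ (- ⌊ q ⌋ℚ) p≤q)))
  ... | tri< ⌊p⌋<⌊q⌋ _ _ = begin
    ⌊ p ⌋ℚ + h (frac p)       ≤⟨ +-monoʳ-≤ ⌊ p ⌋ℚ (subst (h (frac p) ≤ℚ_) h-1 (h-mono (<⇒≤ (frac<1 p)))) ⟩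
    ⌊ p ⌋ℚ + 1ℚ               ≡⟨ +-comm ⌊ p ⌋ℚ 1ℚ ⟩
    1ℚ + ⌊ p ⌋ℚ               ≡⟨ fromℤ-suc (floor p) ⟨
    fromℤ (ℤ.suc (floor p))  ≤⟨ fromℤ-mono-≤ (ℤ.i<j⇒suc[i]≤j ⌊p⌋<⌊q⌋) ⟩
    ⌊ q ⌋ℚ                    ≡⟨ +-identityʳ ⌊ q ⌋ℚ ⟨
    ⌊ q ⌋ℚ + 0ℚ               ≤⟨ +-monoʳ-≤ ⌊ q ⌋ℚ (subst (_≤ℚ h (frac q)) h-0 (h-mono (0≤frac q))) ⟩
    ⌊ q ⌋ℚ + h (frac q)       ∎
    where open ≤-Reasoning
  ... | tri> _ _ ⌊q⌋<⌊p⌋ = contradiction (≤-<-trans (≤-trans ⌊q⌋+1≤p p≤q) (<-fromℤ-suc-floor q)) (<-irrefl refl)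
    where
    ⌊q⌋+1≤p : fromℤ (ℤ.suc (floor q)) ≤ℚ p
    ⌊q⌋+1≤p = ≤-trans (fromℤ-mono-≤ (ℤ.i<j⇒suc[i]≤j ⌊q⌋<⌊p⌋)) (fromℤ-floor-≤ p)

  shiftExtension-isMonotoneLift : IsMonotoneLift (shiftExtension h)
  shiftExtension-isMonotoneLift = record
    { fix-0 = trans (+-identityˡ (h 0ℚ)) h-0
    ; mono  = shiftExtension-mono
    ; shift = λ p → trans (cong₂ _+_ (⌊suc⌋ℚ p) (cong h (frac-suc p))) (+-assoc 1ℚ ⌊ p ⌋ℚ (h (frac p)))
    }

ahead behind : ℚ → ℚ
ahead f = (f + f) ⊓ 1ℚ
behind f = (f + f - 1ℚ) ⊔ 0ℚ

ahead+behind : ∀ f → ahead f + behind f ≡ f + f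
ahead+behind f with ≤-total (f + f) 1ℚ
... | inj₁ 2f≤1 = begin
  ahead f + behind f   ≡⟨ cong₂ _+_ (p≤q⇒p⊓q≡p 2f≤1) (p≤q⇒p⊔q≡q (p≤q⇒p-q≤0 2f≤1)) ⟩
  f + f + 0ℚ           ≡⟨ +-identityʳ (f + f) ⟩
  f + f                ∎
  where open ≡-Reasoning
... | inj₂ 1≤2f = begin
  ahead f + behind f   ≡⟨ cong₂ _+_ (p≥q⇒p⊓q≡q 1≤2f) (p≥q⇒p⊔q≡p (p≤q⇒0≤q-p 1≤2f)) ⟩
  1ℚ + (f + f - 1ℚ)    ≡⟨ cancel (f + f) ⟩
  f + f                ∎
  where
  open ≡-Reasoning
  cancel : ∀ p → 1ℚ + (p - 1ℚ) ≡ p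
  cancel = solve-∀ ℚ-ring

ahead≡behind⇒0 : ∀ {f} → 0ℚ ≤ℚ f → f < 1ℚ → ahead f ≡ behind f → f ≡ 0ℚ
ahead≡behind⇒0 {f} 0≤f f<1 eq with ≤-total (f + f) 1ℚ
... | inj₁ 2f≤1 = ≤-antisym f≤0 0≤f
  where
  2f≡0 : f + f ≡ 0ℚ
  2f≡0 = trans (sym (p≤q⇒p⊓q≡p 2f≤1)) (trans eq (p≤q⇒p⊔q≡q (p≤q⇒p-q≤0 2f≤1)))
  f≤0 : f ≤ℚ 0ℚ
  f≤0 = subst₂ _≤ℚ_ (+-identityʳ f) 2f≡0 (+-monoʳ-≤ f 0≤f)
... | inj₂ 1≤2f = contradiction (+-mono-< f<1 f<1) (<-irrefl 2f≡2)
  where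
  2f≡2 : f + f ≡ 1ℚ + 1ℚ
  2f≡2 = trans (add-back (f + f)) (cong (_+ 1ℚ) (trans (sym (p≥q⇒p⊔q≡p (p≤q⇒0≤q-p 1≤2f)))
                (trans (sym eq) (p≥q⇒p⊓q≡q 1≤2f))))
    where
    add-back : ∀ p → p ≡ p - 1ℚ + 1ℚ
    add-back = solve-∀ ℚ-ring

g⁺ g⁻ : ℚ → ℚ
g⁺ = shiftExtension ahead
g⁻ = shiftExtension behind

g⁺-isMonotoneLift : IsMonotoneLift g⁺
g⁺-isMonotoneLift = shiftExtension-isMonotoneLift (λ p≤q → ⊓-monoˡ-≤ 1ℚ (+-mono-≤ p≤q p≤q)) refl refl

g⁻-isMonotoneLift : IsMonotoneLift g⁻
g⁻-isMonotoneLift = shiftExtension-isMonotoneLift (λ p≤q → ⊔-monoˡ-≤ 0ℚ (+-monoˡ-≤ (- 1ℚ) (+-mono-≤ p≤q p≤q))) refl refl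

g⁺+g⁻ : ∀ p → g⁺ p + g⁻ p ≡ p + p
g⁺+g⁻ p = begin
  (k + ahead (frac p)) + (k + behind (frac p))  ≡⟨ interchange k (ahead (frac p)) (behind (frac p)) ⟩
  (k + k) + (ahead (frac p) + behind (frac p))  ≡⟨ cong ((k + k) +_) (ahead+behind (frac p)) ⟩
  (k + k) + (frac p + frac p)                   ≡⟨ recombine k p ⟩
  p + p                                         ∎
  where
  open ≡-Reasoning
  k = ⌊ p ⌋ℚ
  interchange : ∀ k a b → (k + a) + (k + b) ≡ (k + k) + (a + b)
  interchange = solve-∀ ℚ-ring
  recombine : ∀ k p → (k + k) + ((p - k) + (p - k)) ≡ p + p
  recombine = solve-∀ ℚ-ring

g⁺≡g⁻⇒integral : ∀ p → g⁺ p ≡ g⁻ p → p ≡ ⌊ p ⌋ℚ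
g⁺≡g⁻⇒integral p eq = begin
  p                  ≡⟨ p≡⌊p⌋+frac p ⟩
  ⌊ p ⌋ℚ + frac p    ≡⟨ cong (⌊ p ⌋ℚ +_) frac≡0 ⟩
  ⌊ p ⌋ℚ + 0ℚ        ≡⟨ +-identityʳ ⌊ p ⌋ℚ ⟩
  ⌊ p ⌋ℚ             ∎
  where
  open ≡-Reasoning
  frac≡0 : frac p ≡ 0ℚ
  frac≡0 = ahead≡behind⇒0 (0≤frac p) (frac<1 p) (+-cancelˡ-≡ ⌊ p ⌋ℚ eq)

sgn-suc : ∀ j → sgn (suc j) ≡ - sgn j
sgn-suc j with isEven j
... | true = refl
... | false = refl

sgn*sgn : ∀ j → sgn j * sgn j ≡ 1ℚ
sgn*sgn j with isEven j
... | true = refl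
... | false = refl

sgn-+ : ∀ i j → sgn (i ℕ.+ j) ≡ sgn i * sgn j
sgn-+ zero j = sym (*-identityˡ (sgn j))
sgn-+ (suc i) j = begin
  sgn (suc (i ℕ.+ j))   ≡⟨ sgn-suc (i ℕ.+ j) ⟩
  - sgn (i ℕ.+ j)       ≡⟨ cong -_ (sgn-+ i j) ⟩
  - (sgn i * sgn j)     ≡⟨ neg-distribˡ-* (sgn i) (sgn j) ⟩
  - sgn i * sgn j       ≡⟨ cong (_* sgn j) (sgn-suc i) ⟨
  sgn (suc i) * sgn j   ∎
  where open ≡-Reasoning

isEven-double : ∀ j → isEven (j ℕ.+ j) ≡ true
isEven-double zero = refl
isEven-double (suc j) rewrite ℕ.+-suc j j | isEven-double j = refl

isEven-odd : ∀ j → isEven (suc (j ℕ.+ j)) ≡ false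
isEven-odd j = cong not (isEven-double j)

coord : ∀ {m} → Vec ℚ m → ℕ → ℚ
coord [] t = 0ℚ
coord (a ∷ x) zero = a
coord (a ∷ x) (suc t) = coord x t

coord-ext : ∀ {m} (x y : Vec ℚ m) → (∀ t → t ℕ.< m → coord x t ≡ coord y t) → x ≡ y
coord-ext [] [] _ = refl
coord-ext (a ∷ x) (b ∷ y) eq = cong₂ _∷_ (eq 0 ℕ.z<s) (coord-ext x y (λ t t<m → eq (suc t) (ℕ.s<s t<m)))

coord-tabulate : ∀ {m} (f : ℕ → ℚ) {t} → t ℕ.< m → coord (tabulate {n = m} (λ i → f (toℕ i))) t ≡ f t
coord-tabulate f {zero} ℕ.z<s = refl
coord-tabulate f {suc t} (ℕ.s<s t<m) = coord-tabulate (λ j → f (suc j)) t<m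

coord-zipWith : ∀ {m} (f : ℚ → ℚ → ℚ) (x y : Vec ℚ m) {t} → t ℕ.< m →
                coord (zipWith f x y) t ≡ f (coord x t) (coord y t)
coord-zipWith f (a ∷ x) (b ∷ y) {zero} _ = refl
coord-zipWith f (a ∷ x) (b ∷ y) {suc t} (ℕ.s<s t<m) = coord-zipWith f x y t<m

lookup≡coord : ∀ {m} (x : Vec ℚ m) (i : Fin m) → lookup x i ≡ coord x (toℕ i)
lookup≡coord (a ∷ x) zero = refl
lookup≡coord (a ∷ x) (suc i) = lookup≡coord x i

-- path x t = Σ_{i<t} (-1)^i x_i, where coordinates beyond the end count as 0.
path : ∀ {m} → Vec ℚ m → ℕ → ℚ
path [] t = 0ℚ
path (a ∷ x) zero = 0ℚ
path (a ∷ x) (suc t) = a - path x t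

path-0 : ∀ {m} (x : Vec ℚ m) → path x 0 ≡ 0ℚ
path-0 [] = refl
path-0 (a ∷ x) = refl

path-suc : ∀ {m} (x : Vec ℚ m) t → path x (suc t) ≡ path x t + sgn t * coord x t
path-suc [] t = sym (trans (cong (0ℚ +_) (*-zeroʳ (sgn t))) (+-identityʳ 0ℚ))
path-suc (a ∷ x) zero = trans (cong (λ p → a - p) (path-0 x)) (first-step a)
  where
  first-step : ∀ a → a - 0ℚ ≡ 0ℚ + 1ℚ * a
  first-step = solve-∀ ℚ-ring
path-suc (a ∷ x) (suc t) = begin
  a - path x (suc t)                          ≡⟨ cong (λ p → a - p) (path-suc x t) ⟩
  a - (path x t + sgn t * coord x t)          ≡⟨ regroup a (path x t) (sgn t) (coord x t) ⟩
  (a - path x t) + - sgn t * coord x t        ≡⟨ cong (λ s → (a - path x t) + s * coord x t) (sgn-suc t) ⟨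
  (a - path x t) + sgn (suc t) * coord x t    ∎
  where
  open ≡-Reasoning
  regroup : ∀ a p s c → a - (p + s * c) ≡ (a - p) + - s * c
  regroup = solve-∀ ℚ-ring

coord≡sgn*Δpath : ∀ {m} (x : Vec ℚ m) t → coord x t ≡ sgn t * (path x (suc t) - path x t)
coord≡sgn*Δpath x t = begin
  coord x t                                    ≡⟨ *-identityˡ (coord x t) ⟨
  1ℚ * coord x t                               ≡⟨ cong (_* coord x t) (sgn*sgn t) ⟨
  sgn t * sgn t * coord x t                    ≡⟨ difference (path x t) (sgn t) (coord x t) ⟩
  sgn t * (path x t + sgn t * coord x t - path x t)  ≡⟨ cong (λ p → sgn t * (p - path x t)) (path-suc x t) ⟨
  sgn t * (path x (suc t) - path x t)          ∎
  where
  open ≡-Reasoning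
  difference : ∀ p s c → s * s * c ≡ s * (p + s * c - p)
  difference = solve-∀ ℚ-ring

weightedSum : ∀ {m} → Vec ℚ m → (ℕ → ℚ) → ℚ
weightedSum [] f = 0ℚ
weightedSum (a ∷ x) f = a * f 0 + weightedSum x (λ j → f (suc j))

dot-tabulate : ∀ {m} (x : Vec ℚ m) f → dot x (tabulate (λ i → f (toℕ i))) ≡ weightedSum x f
dot-tabulate [] f = refl
dot-tabulate (a ∷ x) f = cong (a * f 0 +_) (dot-tabulate x (λ j → f (suc j)))

weightedSum-cong : ∀ {m} (x : Vec ℚ m) {f g} → (∀ j → j ℕ.< m → f j ≡ g j) → weightedSum x f ≡ weightedSum x g
weightedSum-cong [] _ = refl
weightedSum-cong (a ∷ x) f≗g =
  cong₂ (λ u v → a * u + v) (f≗g 0 ℕ.z<s) (weightedSum-cong x (λ j j<m → f≗g (suc j) (ℕ.s<s j<m)))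

weightedSum-neg : ∀ {m} (x : Vec ℚ m) f → weightedSum x (λ j → - f j) ≡ - weightedSum x f
weightedSum-neg [] f = refl
weightedSum-neg (a ∷ x) f =
  trans (cong (a * - f 0 +_) (weightedSum-neg x (λ j → f (suc j)))) (distrib a (f 0) (weightedSum x (λ j → f (suc j))))
  where
  distrib : ∀ a u w → a * - u + - w ≡ - (a * u + w)
  distrib = solve-∀ ℚ-ring

weightedSum-minus : ∀ {m} (x : Vec ℚ m) f g → weightedSum x (λ j → f j - g j) ≡ weightedSum x f - weightedSum x g
weightedSum-minus [] f g = refl
weightedSum-minus (a ∷ x) f g =
  trans (cong (a * (f 0 - g 0) +_) (weightedSum-minus x (λ j → f (suc j)) (λ j → g (suc j))))
        (distrib a (f 0) (g 0) (weightedSum x (λ j → f (suc j))) (weightedSum x (λ j → g (suc j))))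
  where
  distrib : ∀ a u v w z → a * (u - v) + (w - z) ≡ (a * u + w) - (a * v + z)
  distrib = solve-∀ ℚ-ring

prefixSigns : ℕ → ℕ → ℚ
prefixSigns t j = if does (j ℕ.<? t) then sgn j else 0ℚ

weightedSum-prefixSigns : ∀ {m} (x : Vec ℚ m) t → weightedSum x (prefixSigns t) ≡ path x t
weightedSum-prefixSigns [] t = refl
weightedSum-prefixSigns (a ∷ x) zero = trans (cong (a * 0ℚ +_) (trans (weightedSum-prefixSigns x 0) (path-0 x))) (a*0+0 a)
  where
  a*0+0 : ∀ a → a * 0ℚ + 0ℚ ≡ 0ℚ
  a*0+0 = solve-∀ ℚ-ring
weightedSum-prefixSigns (a ∷ x) (suc t) = begin
  a * 1ℚ + weightedSum x (prefixSigns (suc t) ∘ suc)   ≡⟨ cong (a * 1ℚ +_) (weightedSum-cong x (λ j _ → shift j)) ⟩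
  a * 1ℚ + weightedSum x (λ j → - prefixSigns t j)     ≡⟨ cong (a * 1ℚ +_) (weightedSum-neg x (prefixSigns t)) ⟩
  a * 1ℚ + - weightedSum x (prefixSigns t)             ≡⟨ cong (λ w → a * 1ℚ + - w) (weightedSum-prefixSigns x t) ⟩
  a * 1ℚ + - path x t                                  ≡⟨ cong (_- path x t) (*-identityʳ a) ⟩
  a - path x t                                         ∎
  where
  open ≡-Reasoning
  shift : ∀ j → prefixSigns (suc t) (suc j) ≡ - prefixSigns t j
  shift j with j ℕ.<ᵇ t
  ... | true = sgn-suc j
  ... | false = refl

suffixSigns : ℕ → ℕ → ℚ
suffixSigns p j = if does (j ℕ.<? p) then 0ℚ else - sgn (j ℕ.∸ p)

suffixSigns≡prefixSigns-prefixSigns : ∀ {m p j} → isEven p ≡ false → j ℕ.< m →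
                                      suffixSigns p j ≡ prefixSigns m j - prefixSigns p j
suffixSigns≡prefixSigns-prefixSigns {m} {p} {j} p-odd j<m with j ℕ.<ᵇ p in j<ᵇp | j ℕ.<ᵇ m in j<ᵇm
... | true | true = sym (+-inverseʳ (sgn j))
... | _ | false = ⊥-elim (subst T j<ᵇm (ℕ.<⇒<ᵇ j<m))
... | false | true = begin
  - sgn (j ℕ.∸ p)          ≡⟨ cong -_ (*-identityˡ (sgn (j ℕ.∸ p))) ⟨
  - (1ℚ * sgn (j ℕ.∸ p))   ≡⟨ neg-distribˡ-* 1ℚ (sgn (j ℕ.∸ p)) ⟩
  - 1ℚ * sgn (j ℕ.∸ p)     ≡⟨ cong (_* sgn (j ℕ.∸ p)) (sgn-isOdd {p} p-odd) ⟨
  sgn p * sgn (j ℕ.∸ p)    ≡⟨ sgn-+ p (j ℕ.∸ p) ⟨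
  sgn (p ℕ.+ (j ℕ.∸ p))    ≡⟨ cong sgn (ℕ.m+[n∸m]≡n p≤j) ⟩
  sgn j                    ≡⟨ +-identityʳ (sgn j) ⟨
  sgn j - 0ℚ               ∎
  where
  open ≡-Reasoning
  p≤j : p ℕ.≤ j
  p≤j = ℕ.≮⇒≥ (λ j<p → subst T j<ᵇp (ℕ.<⇒<ᵇ j<p))
  sgn-isOdd : ∀ {p} → isEven p ≡ false → sgn p ≡ - 1ℚ
  sgn-isOdd eq rewrite eq = refl

dot-wvec : ∀ {m} (x : Vec ℚ m) k → dot x (wvec m k) ≡ path x (2 ℕ.* k)
dot-wvec x k = trans (dot-tabulate x (prefixSigns (2 ℕ.* k))) (weightedSum-prefixSigns x (2 ℕ.* k))

dot-uvec : ∀ {m} (x : Vec ℚ m) k → isEven (m ℕ.∸ 2 ℕ.* k) ≡ false →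
           dot x (uvec m k) ≡ path x m - path x (m ℕ.∸ 2 ℕ.* k)
dot-uvec {m} x k p-odd = begin
  dot x (uvec m k)                                        ≡⟨ dot-tabulate x (suffixSigns p) ⟩
  weightedSum x (suffixSigns p)
                         ≡⟨ weightedSum-cong x (λ j j<m → suffixSigns≡prefixSigns-prefixSigns {m} {p} p-odd j<m) ⟩
  weightedSum x (λ j → prefixSigns m j - prefixSigns p j) ≡⟨ weightedSum-minus x (prefixSigns m) (prefixSigns p) ⟩
  weightedSum x (prefixSigns m) - weightedSum x (prefixSigns p)
                                 ≡⟨ cong₂ _-_ (weightedSum-prefixSigns x m) (weightedSum-prefixSigns x p) ⟩
  path x m - path x p                                     ∎
  where
  open ≡-Reasoning
  p = m ℕ.∸ 2 ℕ.* k

data Parity : ℕ → Set where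
  even : ∀ j → Parity (j ℕ.+ j)
  odd  : ∀ j → Parity (suc (j ℕ.+ j))

parity : ∀ t → Parity t
parity zero = even 0
parity (suc t) with parity t
... | even j = odd j
... | odd j = subst Parity (cong suc (ℕ.+-suc j j)) (even (suc j))

double≤odd⇒≤ : ∀ {i j} → j ℕ.+ j ℕ.≤ suc (i ℕ.+ i) → j ℕ.≤ i
double≤odd⇒≤ {i} {j} 2j≤2i+1 = ℕ.≮⇒≥ λ i<j →
  ℕ.<-irrefl refl (ℕ.≤-trans (subst (ℕ._≤ j ℕ.+ j) (cong suc (ℕ.+-suc i i)) (ℕ.+-mono-≤ i<j i<j)) 2j≤2i+1)

dim-suc : ∀ n' → dim (suc n') ≡ suc (n' ℕ.+ n')
dim-suc n' = trans (ℕ.+-suc n' (n' ℕ.+ 0)) (cong (λ k → suc (n' ℕ.+ k)) (ℕ.+-identityʳ n'))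

2*k≡k+k : ∀ k → 2 ℕ.* k ≡ k ℕ.+ k
2*k≡k+k k = cong (k ℕ.+_) (ℕ.+-identityʳ k)

dim∸2*k : ∀ n' {k} → k ℕ.≤ n' → dim (suc n') ℕ.∸ 2 ℕ.* k ≡ suc ((n' ℕ.∸ k) ℕ.+ (n' ℕ.∸ k))
dim∸2*k n' {k} k≤n' = begin
  dim (suc n') ℕ.∸ 2 ℕ.* k                    ≡⟨ cong (ℕ._∸ 2 ℕ.* k) (dim-suc n') ⟩
  suc (n' ℕ.+ n') ℕ.∸ 2 ℕ.* k                 ≡⟨ cong (λ n → suc (n ℕ.+ n) ℕ.∸ 2 ℕ.* k) (ℕ.m+[n∸m]≡n k≤n') ⟨
  suc ((k ℕ.+ d) ℕ.+ (k ℕ.+ d)) ℕ.∸ 2 ℕ.* k   ≡⟨ cong (ℕ._∸ 2 ℕ.* k) (regroup k d) ⟩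
  2 ℕ.* k ℕ.+ suc (d ℕ.+ d) ℕ.∸ 2 ℕ.* k       ≡⟨ ℕ.m+n∸m≡n (2 ℕ.* k) (suc (d ℕ.+ d)) ⟩
  suc (d ℕ.+ d)                               ∎
  where
  open ≡-Reasoning
  d = n' ℕ.∸ k
  regroup : ∀ k d → suc ((k ℕ.+ d) ℕ.+ (k ℕ.+ d)) ≡ 2 ℕ.* k ℕ.+ suc (d ℕ.+ d)
  regroup = solve-∀ ℕ-ring

2*k≤dim : ∀ n' {k} → k ℕ.≤ n' → 2 ℕ.* k ℕ.≤ dim (suc n')
2*k≤dim n' {k} k≤n' = subst₂ ℕ._≤_ (sym (2*k≡k+k k)) (sym (dim-suc n')) (ℕ.m≤n⇒m≤1+n (ℕ.+-mono-≤ k≤n' k≤n'))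

Box : ∀ {m} → Vec ℚ m → Set
Box {m} x = ∀ t → t ℕ.< m → 0ℚ ≤ℚ coord x t × coord x t ≤ℚ 1ℚ

BallotPath : (ℕ → ℚ) → ℕ → Set
BallotPath P m = ∀ t → t ℕ.≤ m → 0ℚ ≤ℚ P t × P t ≤ℚ P m

path-even-step : ∀ {m} {x : Vec ℚ m} → Box x → ∀ j → j ℕ.+ j ℕ.< m → path x (j ℕ.+ j) ≤ℚ path x (suc (j ℕ.+ j))
path-even-step {x = x} box j 2j<m = begin
  path x (j ℕ.+ j)                                   ≡⟨ +-identityʳ (path x (j ℕ.+ j)) ⟨
  path x (j ℕ.+ j) + 0ℚ                              ≤⟨ +-monoʳ-≤ (path x (j ℕ.+ j)) (proj₁ (box (j ℕ.+ j) 2j<m)) ⟩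
  path x (j ℕ.+ j) + coord x (j ℕ.+ j)               ≡⟨ cong (path x (j ℕ.+ j) +_) (*-identityˡ (coord x (j ℕ.+ j))) ⟨
  path x (j ℕ.+ j) + 1ℚ * coord x (j ℕ.+ j)          ≡⟨ cong (λ s → path x (j ℕ.+ j) + s * coord x (j ℕ.+ j)) (sgn-even j) ⟨
  path x (j ℕ.+ j) + sgn (j ℕ.+ j) * coord x (j ℕ.+ j)  ≡⟨ path-suc x (j ℕ.+ j) ⟨
  path x (suc (j ℕ.+ j))                             ∎
  where
  open ≤-Reasoning
  sgn-even : ∀ j → sgn (j ℕ.+ j) ≡ 1ℚ
  sgn-even j rewrite isEven-double j = refl

isEven-dim∸2*k : ∀ n' {k} → k ℕ.≤ n' → isEven (dim (suc n') ℕ.∸ 2 ℕ.* k) ≡ false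
isEven-dim∸2*k n' {k} k≤n' = trans (cong isEven (dim∸2*k n' k≤n')) (isEven-odd (n' ℕ.∸ k))

module _ (n' : ℕ) (x : Vec ℚ (dim (suc n'))) where
  private
    m = dim (suc n')
    2j<m : ∀ {j} → j ℕ.≤ n' → j ℕ.+ j ℕ.< m
    2j<m {j} j≤n' = subst (suc (j ℕ.+ j) ℕ.≤_) (sym (dim-suc n')) (ℕ.s≤s (ℕ.+-mono-≤ j≤n' j≤n'))

  inPolytope⇒box : InPolytope (suc n') x → Box x
  inPolytope⇒box (box , _) t t<m = subst (λ q → 0ℚ ≤ℚ q × q ≤ℚ 1ℚ) lookup≡ (box (fromℕ< t<m))
    where
    lookup≡ : lookup x (fromℕ< t<m) ≡ coord x t
    lookup≡ = trans (lookup≡coord x (fromℕ< t<m)) (cong (coord x) (toℕ-fromℕ< t<m))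

  inPolytope⇒path-even : InPolytope (suc n') x → ∀ j → j ℕ.≤ n' → 0ℚ ≤ℚ path x (j ℕ.+ j)
  inPolytope⇒path-even _ zero _ = ≤-reflexive (sym (path-0 x))
  inPolytope⇒path-even (_ , ballots) (suc j) j<n' =
    subst (0ℚ ≤ℚ_) (trans (dot-wvec x (suc j)) (cong (path x) (2*k≡k+k (suc j)))) (proj₁ (ballots (suc j) ℕ.z<s j<n'))

  inPolytope⇒path-odd : InPolytope (suc n') x → ∀ j → j ℕ.≤ n' → path x (suc (j ℕ.+ j)) ≤ℚ path x m
  inPolytope⇒path-odd (_ , ballots) j j≤n' with ℕ.m≤n⇒m<n∨m≡n j≤n'
  ... | inj₂ refl = ≤-reflexive (cong (path x) (sym (dim-suc n')))
  ... | inj₁ j<n' = subst (λ t → path x t ≤ℚ path x m) m∸2k≡2j+1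
                      (0≤q-p⇒p≤q (subst (0ℚ ≤ℚ_) (dot-uvec x k (isEven-dim∸2*k n' k≤n')) (proj₂ (ballots k 1≤k k≤n'))))
    where
    k = n' ℕ.∸ j
    1≤k : 1 ℕ.≤ k
    1≤k = ℕ.m<n⇒0<n∸m j<n'
    k≤n' : k ℕ.≤ n'
    k≤n' = ℕ.m∸n≤m n' j
    m∸2k≡2j+1 : m ℕ.∸ 2 ℕ.* k ≡ suc (j ℕ.+ j)
    m∸2k≡2j+1 = trans (dim∸2*k n' k≤n') (cong (λ i → suc (i ℕ.+ i)) (ℕ.m∸[m∸n]≡n j≤n'))

  inPolytope⇒ballotPath : InPolytope (suc n') x → BallotPath (path x) m
  inPolytope⇒ballotPath ip t t≤m with parity t
  ... | even j = inPolytope⇒path-even ip j j≤n' ,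
                 ≤-trans (path-even-step {x = x} (inPolytope⇒box ip) j (2j<m j≤n')) (inPolytope⇒path-odd ip j j≤n')
    where
    j≤n' : j ℕ.≤ n'
    j≤n' = double≤odd⇒≤ (subst (j ℕ.+ j ℕ.≤_) (dim-suc n') t≤m)
  ... | odd j = ≤-trans (inPolytope⇒path-even ip j j≤n') (path-even-step {x = x} (inPolytope⇒box ip) j (2j<m j≤n')) ,
                inPolytope⇒path-odd ip j j≤n'
    where
    j≤n' : j ℕ.≤ n'
    j≤n' = double≤odd⇒≤ (ℕ.≤-trans (ℕ.n≤1+n (j ℕ.+ j)) (subst (suc (j ℕ.+ j) ℕ.≤_) (dim-suc n') t≤m))

  ballotPath⇒inPolytope : Box x → BallotPath (path x) m → InPolytope (suc n') x
  ballotPath⇒inPolytope box ballot =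
    (λ i → subst (λ q → 0ℚ ≤ℚ q × q ≤ℚ 1ℚ) (sym (lookup≡coord x i)) (box (toℕ i) (toℕ<n i))) ,
    λ k _ k≤n' →
      subst (0ℚ ≤ℚ_) (sym (dot-wvec x k)) (proj₁ (ballot (2 ℕ.* k) (2*k≤dim n' k≤n'))) ,
      subst (0ℚ ≤ℚ_) (sym (dot-uvec x k (isEven-dim∸2*k n' k≤n')))
        (p≤q⇒0≤q-p (proj₂ (ballot (m ℕ.∸ 2 ℕ.* k) (ℕ.m∸n≤m m (2 ℕ.* k)))))

fromPath : ∀ {m} → (ℕ → ℚ) → Vec ℚ m
fromPath P = tabulate (λ i → sgn (toℕ i) * (P (suc (toℕ i)) - P (toℕ i)))

coord-fromPath : ∀ {m} P {t} → t ℕ.< m → coord (fromPath {m} P) t ≡ sgn t * (P (suc t) - P t)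
coord-fromPath P = coord-tabulate (λ j → sgn j * (P (suc j) - P j))

path-fromPath : ∀ {m} P → P 0 ≡ 0ℚ → ∀ t → t ℕ.≤ m → path (fromPath {m} P) t ≡ P t
path-fromPath {m} P P0 zero _ = trans (path-0 (fromPath {m} P)) (sym P0)
path-fromPath {m} P P0 (suc t) t<m = begin
  path y (suc t)                                   ≡⟨ path-suc y t ⟩
  path y t + sgn t * coord y t                     ≡⟨ cong₂ (λ p c → p + sgn t * c) (path-fromPath P P0 t (ℕ.<⇒≤ t<m))
                                                            (coord-fromPath P t<m) ⟩
  P t + sgn t * (sgn t * (P (suc t) - P t))        ≡⟨ regroup (P t) (P (suc t)) (sgn t) ⟩
  P t + sgn t * sgn t * (P (suc t) - P t)          ≡⟨ cong (λ s → P t + s * (P (suc t) - P t)) (sgn*sgn t) ⟩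
  P t + 1ℚ * (P (suc t) - P t)                     ≡⟨ telescope (P t) (P (suc t)) ⟩
  P (suc t)                                        ∎
  where
  open ≡-Reasoning
  y = fromPath {m} P
  regroup : ∀ p q s → p + s * (s * (q - p)) ≡ p + s * s * (q - p)
  regroup = solve-∀ ℚ-ring
  telescope : ∀ p q → p + 1ℚ * (q - p) ≡ q
  telescope = solve-∀ ℚ-ring

mapPath : ∀ {m} → (ℚ → ℚ) → Vec ℚ m → Vec ℚ m
mapPath g x = fromPath (g ∘ path x)

sgn-cases : ∀ j → sgn j ≡ 1ℚ ⊎ sgn j ≡ - 1ℚ
sgn-cases j with isEven j
... | true = inj₁ refl
... | false = inj₂ refl

module _ {g : ℚ → ℚ} (lift : IsMonotoneLift g) where
  open IsMonotoneLift lift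

  unit-step : ∀ {q} → 0ℚ ≤ℚ q → q ≤ℚ 1ℚ → ∀ a → 0ℚ ≤ℚ g (a + q) - g a × g (a + q) - g a ≤ℚ 1ℚ
  unit-step {q} 0≤q q≤1 a =
    p≤q⇒0≤q-p (mono a≤a+q) , 0≤q-p⇒p≤q (subst (0ℚ ≤ℚ_) (reorder (g a) (g (a + q))) (p≤q⇒0≤q-p ga+q≤1+ga))
    where
    a≤a+q : a ≤ℚ a + q
    a≤a+q = subst (_≤ℚ a + q) (+-identityʳ a) (+-monoʳ-≤ a 0≤q)
    ga+q≤1+ga : g (a + q) ≤ℚ 1ℚ + g a
    ga+q≤1+ga = subst (g (a + q) ≤ℚ_) (trans (cong g (+-comm a 1ℚ)) (shift a)) (mono (+-monoʳ-≤ a q≤1))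
    reorder : ∀ u v → 1ℚ + u - v ≡ 1ℚ - (v - u)
    reorder = solve-∀ ℚ-ring

  signed-unit-step : ∀ {q} → 0ℚ ≤ℚ q → q ≤ℚ 1ℚ → ∀ j a →
                     0ℚ ≤ℚ sgn j * (g (a + sgn j * q) - g a) × sgn j * (g (a + sgn j * q) - g a) ≤ℚ 1ℚ
  signed-unit-step {q} 0≤q q≤1 j a with sgn j | sgn-cases j
  ... | _ | inj₁ refl = subst (λ r → 0ℚ ≤ℚ r × r ≤ℚ 1ℚ) (upward a q) (unit-step 0≤q q≤1 a)
    where
    upward : ∀ a q → g (a + q) - g a ≡ 1ℚ * (g (a + 1ℚ * q) - g a)
    upward a q = trans (cong (λ b → g b - g a) (cong (a +_) (sym (*-identityˡ q)))) (sym (*-identityˡ _))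
  ... | _ | inj₂ refl = subst (λ r → 0ℚ ≤ℚ r × r ≤ℚ 1ℚ) downward (unit-step 0≤q q≤1 a')
    where
    a' = a + - 1ℚ * q
    downward : g (a' + q) - g a' ≡ - 1ℚ * (g a' - g a)
    downward = trans (cong (λ b → g b - g a') (back a q)) (flip (g a) (g a'))
      where
      back : ∀ a q → a + - 1ℚ * q + q ≡ a
      back = solve-∀ ℚ-ring
      flip : ∀ u v → u - v ≡ - 1ℚ * (v - u)
      flip = solve-∀ ℚ-ring

  path-mapPath : ∀ {m} (x : Vec ℚ m) t → t ℕ.≤ m → path (mapPath g x) t ≡ g (path x t)
  path-mapPath x = path-fromPath (g ∘ path x) (trans (cong g (path-0 x)) fix-0)

  mapPath-box : ∀ {m} {x : Vec ℚ m} → Box x → Box (mapPath g x)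
  mapPath-box {x = x} box t t<m =
    subst (λ r → 0ℚ ≤ℚ r × r ≤ℚ 1ℚ) (sym coord≡)
      (signed-unit-step (proj₁ (box t t<m)) (proj₂ (box t t<m)) t (path x t))
    where
    coord≡ : coord (mapPath g x) t ≡ sgn t * (g (path x t + sgn t * coord x t) - g (path x t))
    coord≡ = trans (coord-fromPath (g ∘ path x) t<m) (cong (λ p → sgn t * (g p - g (path x t))) (path-suc x t))

  mapPath-ballotPath : ∀ {m} {x : Vec ℚ m} → BallotPath (path x) m → BallotPath (path (mapPath g x)) m
  mapPath-ballotPath {m} {x} ballot t t≤m =
    subst (0ℚ ≤ℚ_) (sym (path-mapPath x t t≤m)) (subst (_≤ℚ g (path x t)) fix-0 (mono (proj₁ (ballot t t≤m)))) ,
    subst₂ _≤ℚ_ (sym (path-mapPath x t t≤m)) (sym (path-mapPath x m ℕ.≤-refl)) (mono (proj₂ (ballot t t≤m)))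

  mapPath-inPolytope : ∀ n' (x : Vec ℚ (dim (suc n'))) → InPolytope (suc n') x → InPolytope (suc n') (mapPath g x)
  mapPath-inPolytope n' x ip =
    ballotPath⇒inPolytope n' (mapPath g x) (mapPath-box {x = x} (inPolytope⇒box n' x ip))
                                           (mapPath-ballotPath {x = x} (inPolytope⇒ballotPath n' x ip))

coord-convex-mapPath : ∀ {m} (x : Vec ℚ m) {t} → t ℕ.< m → coord (convex ½ (mapPath g⁺ x) (mapPath g⁻ x)) t ≡ coord x t
coord-convex-mapPath {m} x {t} t<m = begin
  coord (convex ½ y z) t                               ≡⟨ coord-zipWith (λ a b → ½ * a + (1ℚ - ½) * b) y z t<m ⟩
  ½ * coord y t + ½ * coord z t                        ≡⟨ cong₂ (λ a b → ½ * a + ½ * b) (coord-fromPath (g⁺ ∘ path x) t<m)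
                                                                                       (coord-fromPath (g⁻ ∘ path x) t<m) ⟩
  ½ * (sgn t * (g⁺ P′ - g⁺ P)) + ½ * (sgn t * (g⁻ P′ - g⁻ P))
                                ≡⟨ collect ½ (sgn t) (g⁺ P) (g⁺ P′) (g⁻ P) (g⁻ P′) ⟩
  ½ * sgn t * ((g⁺ P′ + g⁻ P′) - (g⁺ P + g⁻ P))        ≡⟨ cong₂ (λ a b → ½ * sgn t * (a - b)) (g⁺+g⁻ P′) (g⁺+g⁻ P) ⟩
  ½ * sgn t * ((P′ + P′) - (P + P))                    ≡⟨ halve ½ (sgn t) P P′ ⟩
  (½ + ½) * (sgn t * (P′ - P))                         ≡⟨ *-identityˡ (sgn t * (P′ - P)) ⟩
  sgn t * (P′ - P)                                     ≡⟨ coord≡sgn*Δpath x t ⟨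
  coord x t                                            ∎
  where
  open ≡-Reasoning
  y = mapPath g⁺ x
  z = mapPath g⁻ x
  P = path x t
  P′ = path x (suc t)
  collect : ∀ h s a a′ b b′ → h * (s * (a′ - a)) + h * (s * (b′ - b)) ≡ h * s * ((a′ + b′) - (a + b))
  collect = solve-∀ ℚ-ring
  halve : ∀ h s p p′ → h * s * ((p′ + p′) - (p + p)) ≡ (h + h) * (s * (p′ - p))
  halve = solve-∀ ℚ-ring

convex-mapPath : ∀ {m} (x : Vec ℚ m) → convex ½ (mapPath g⁺ x) (mapPath g⁻ x) ≡ x
convex-mapPath x = coord-ext _ x (λ t → coord-convex-mapPath x)

Integral : ℚ → Set
Integral q = ∃ λ k → q ≡ fromℤ k

integral-minus : ∀ {p q} → Integral p → Integral q → Integral (p - q)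
integral-minus (k , refl) (l , refl) = k ℤ.- l , sym (fromℤ-minus k l)

integral-sgn* : ∀ j {q} → Integral q → Integral (sgn j * q)
integral-sgn* j {q} (k , refl) with sgn j | sgn-cases j
... | _ | inj₁ refl = k , *-identityˡ (fromℤ k)
... | _ | inj₂ refl = ℤ.- k , trans (sym (neg-distribˡ-* 1ℚ (fromℤ k)))
                                    (trans (cong -_ (*-identityˡ (fromℤ k))) (sym (fromℤ-neg k)))

integral-unit : ∀ {q} → Integral q → 0ℚ ≤ℚ q → q ≤ℚ 1ℚ → q ≡ 0ℚ ⊎ q ≡ 1ℚ
integral-unit (ℤ.+ 0 , refl) _ _ = inj₁ refl
integral-unit (ℤ.+ 1 , refl) _ _ = inj₂ refl
integral-unit (ℤ.+ suc (suc n) , refl) _ q≤1 with fromℤ-cancel-≤ {ℤ.+ suc (suc n)} {ℤ.+ 1} q≤1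
... | ℤ.+≤+ (ℕ.s≤s ())
integral-unit (ℤ.-[1+ n ] , refl) 0≤q _ with fromℤ-cancel-≤ {ℤ.+ 0} {ℤ.-[1+ n ]} 0≤q
... | ()

module _ (n' : ℕ) (x : Vec ℚ (dim (suc n'))) (vertex : IsVertex (suc n') x) where
  private
    m = dim (suc n')
    ip = proj₁ vertex

  vertex⇒integral-path : ∀ t → t ℕ.≤ m → Integral (path x t)
  vertex⇒integral-path t t≤m = floor (path x t) , g⁺≡g⁻⇒integral (path x t) (begin
    g⁺ (path x t)             ≡⟨ path-mapPath g⁺-isMonotoneLift x t t≤m ⟨
    path (mapPath g⁺ x) t     ≡⟨ cong (λ y → path y t) split-equal ⟩
    path (mapPath g⁻ x) t     ≡⟨ path-mapPath g⁻-isMonotoneLift x t t≤m ⟩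
    g⁻ (path x t)             ∎)
    where
    open ≡-Reasoning
    split-equal : mapPath g⁺ x ≡ mapPath g⁻ x
    split-equal = proj₂ vertex (mapPath g⁺ x) (mapPath g⁻ x) ½
      (mapPath-inPolytope g⁺-isMonotoneLift n' x ip) (mapPath-inPolytope g⁻-isMonotoneLift n' x ip)
      (*<* (ℤ.+<+ ℕ.z<s)) (*<* (ℤ.+<+ (ℕ.s<s ℕ.z<s))) (sym (convex-mapPath x))

  vertex⇒binary-coords : ∀ t → t ℕ.< m → coord x t ≡ 0ℚ ⊎ coord x t ≡ 1ℚ
  vertex⇒binary-coords t t<m = integral-unit integral (proj₁ (box t t<m)) (proj₂ (box t t<m))
    where
    box = inPolytope⇒box n' x ip
    integral : Integral (coord x t)
    integral = subst Integral (sym (coord≡sgn*Δpath x t))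
      (integral-sgn* t (integral-minus (vertex⇒integral-path (suc t) t<m) (vertex⇒integral-path t (ℕ.<⇒≤ t<m))))

bitℤ : Bool → ℤ
bitℤ true = 1ℤ
bitℤ false = 0ℤ

bit : Bool → ℚ
bit c = fromℤ (bitℤ c)

binary : ∀ {m} → Vec Bool m → Vec ℚ m
binary = Vec.map bit

binary-coords⇒binary : ∀ {m} (x : Vec ℚ m) → (∀ t → t ℕ.< m → coord x t ≡ 0ℚ ⊎ coord x t ≡ 1ℚ) → ∃ λ b → x ≡ binary b
binary-coords⇒binary [] _ = [] , refl
binary-coords⇒binary (a ∷ x) coords with binary-coords⇒binary x (λ t t<m → coords (suc t) (ℕ.s<s t<m)) | coords 0 ℕ.z<s
... | b , refl | inj₁ refl = false ∷ b , refl
... | b , refl | inj₂ refl = true ∷ b , refl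

vertex⇒binary-point : ∀ n' (x : Vec ℚ (dim (suc n'))) → IsVertex (suc n') x → ∃ λ b → x ≡ binary b
vertex⇒binary-point n' x vertex = binary-coords⇒binary x (vertex⇒binary-coords n' x vertex)

s*u+r*w≡0⇒u≡0 : ∀ {s r u w} → 0ℚ < s → 0ℚ ≤ℚ r → 0ℚ ≤ℚ u → 0ℚ ≤ℚ w → s * u + r * w ≡ 0ℚ → u ≡ 0ℚ
s*u+r*w≡0⇒u≡0 {s} {r} {u} {w} 0<s 0≤r 0≤u 0≤w sum≡0 = ≤-antisym (*-cancelˡ-≤-pos s {{positive 0<s}} su≤s0) 0≤u
  where
  0≤rw : 0ℚ ≤ℚ r * w
  0≤rw = subst (_≤ℚ r * w) (*-zeroʳ r) (*-monoˡ-≤-nonNeg r {{nonNegative 0≤r}} 0≤w)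
  su≤s0 : s * u ≤ℚ s * 0ℚ
  su≤s0 = subst₂ _≤ℚ_ (+-identityʳ (s * u)) (trans sum≡0 (sym (*-zeroʳ s))) (+-monoʳ-≤ (s * u) 0≤rw)

module _ {t : ℚ} (0<t : 0ℚ < t) (t<1 : t < 1ℚ) where
  private
    0<1-t : 0ℚ < 1ℚ - t
    0<1-t = subst (_< 1ℚ - t) (+-inverseʳ t) (+-monoˡ-< (- t) t<1)

  binary-extreme : ∀ {q a c} → q ≡ 0ℚ ⊎ q ≡ 1ℚ → 0ℚ ≤ℚ a → a ≤ℚ 1ℚ → 0ℚ ≤ℚ c → c ≤ℚ 1ℚ →
                   q ≡ t * a + (1ℚ - t) * c → a ≡ q × c ≡ q
  binary-extreme {a = a} {c} (inj₁ refl) 0≤a _ 0≤c _ eq =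
    s*u+r*w≡0⇒u≡0 0<t (<⇒≤ 0<1-t) 0≤a 0≤c (sym eq) ,
    s*u+r*w≡0⇒u≡0 0<1-t (<⇒≤ 0<t) 0≤c 0≤a (trans (+-comm ((1ℚ - t) * c) (t * a)) (sym eq))
  binary-extreme {a = a} {c} (inj₂ refl) _ a≤1 _ c≤1 eq =
    complement a (s*u+r*w≡0⇒u≡0 0<t (<⇒≤ 0<1-t) (p≤q⇒0≤q-p a≤1) (p≤q⇒0≤q-p c≤1) complements≡0) ,
    complement c (s*u+r*w≡0⇒u≡0 0<1-t (<⇒≤ 0<t) (p≤q⇒0≤q-p c≤1) (p≤q⇒0≤q-p a≤1)
                   (trans (+-comm ((1ℚ - t) * (1ℚ - c)) (t * (1ℚ - a))) complements≡0))
    where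
    complements≡0 : t * (1ℚ - a) + (1ℚ - t) * (1ℚ - c) ≡ 0ℚ
    complements≡0 = trans (expand t a c) (trans (cong (λ p → 1ℚ - p) (sym eq)) (+-inverseʳ 1ℚ))
      where
      expand : ∀ t a c → t * (1ℚ - a) + (1ℚ - t) * (1ℚ - c) ≡ 1ℚ - (t * a + (1ℚ - t) * c)
      expand = solve-∀ ℚ-ring
    complement : ∀ a → 1ℚ - a ≡ 0ℚ → a ≡ 1ℚ
    complement a eq′ = trans (back a) (cong (λ p → 1ℚ - p) eq′)
      where
      back : ∀ a → a ≡ 1ℚ - (1ℚ - a)
      back = solve-∀ ℚ-ring

bit-binary : ∀ c → bit c ≡ 0ℚ ⊎ bit c ≡ 1ℚ
bit-binary true = inj₂ refl
bit-binary false = inj₁ refl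

lookup-ext : ∀ {m} {A : Set} {y z : Vec A m} → (∀ i → lookup y i ≡ lookup z i) → y ≡ z
lookup-ext {y = y} {z} eq = trans (sym (tabulate∘lookup y)) (trans (tabulate-cong eq) (tabulate∘lookup z))

binary⇒vertex : ∀ n (b : Vec Bool (dim n)) → InPolytope n (binary b) → IsVertex n (binary b)
binary⇒vertex n b ip = ip , λ y z t ipy ipz 0<t t<1 b≡yz → lookup-ext λ i →
  let q≡ty+[1-t]z = trans (cong (λ v → lookup v i) b≡yz) (lookup-zipWith (λ a c → t * a + (1ℚ - t) * c) i y z)
      q-binary = subst (λ q → q ≡ 0ℚ ⊎ q ≡ 1ℚ) (sym (lookup-map i bit b)) (bit-binary (lookup b i))
      (y≡q , z≡q) = binary-extreme 0<t t<1 q-binary (proj₁ (proj₁ ipy i)) (proj₂ (proj₁ ipy i))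
                                    (proj₁ (proj₁ ipz i)) (proj₂ (proj₁ ipz i)) q≡ty+[1-t]z
  in trans y≡q (sym z≡q)

≤-by-difference : ∀ {a b c d} → b ℤ.- a ≡ d ℤ.- c → a ℤ.≤ b → c ℤ.≤ d
≤-by-difference eq a≤b = ℤ.0≤i-j⇒j≤i (subst (0ℤ ℤ.≤_) eq (ℤ.i≤j⇒0≤j-i a≤b))

<-by-difference : ∀ {a b c d} → b ℤ.- a ≡ d ℤ.- c → a ℤ.< b → c ℤ.< d
<-by-difference {a} {b} {c} {d} eq a<b =
  ℤ.suc[i]≤j⇒i<j (≤-by-difference (trans (less-one b a) (trans (cong (ℤ._- 1ℤ) eq) (sym (less-one d c))))
                                   (ℤ.i<j⇒suc[i]≤j a<b))
  where
  less-one : ∀ b a → b ℤ.- (1ℤ ℤ.+ a) ≡ (b ℤ.- a) ℤ.- 1ℤ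
  less-one = solve-∀ ℤ-ring

step : Bool → ℤ
step true = 1ℤ
step false = -1ℤ

height : List Bool → ℤ
height [] = 0ℤ
height (c ∷ l) = step c ℤ.+ height l

zeros+height≡ones : ∀ l → ℤ.+ zeros l ℤ.+ height l ≡ ℤ.+ ones l
zeros+height≡ones [] = refl
zeros+height≡ones (true ∷ l) = trans (swap (ℤ.+ zeros l) (height l)) (cong (λ k → 1ℤ ℤ.+ k) (zeros+height≡ones l))
  where
  swap : ∀ z h → z ℤ.+ (1ℤ ℤ.+ h) ≡ 1ℤ ℤ.+ (z ℤ.+ h)
  swap = solve-∀ ℤ-ring
zeros+height≡ones (false ∷ l) = trans (cancel (ℤ.+ zeros l) (height l)) (zeros+height≡ones l)
  where
  cancel : ∀ z h → (1ℤ ℤ.+ z) ℤ.+ (-1ℤ ℤ.+ h) ≡ z ℤ.+ h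
  cancel = solve-∀ ℤ-ring

ones-zeros≡height : ∀ l → ℤ.+ ones l ℤ.- ℤ.+ zeros l ≡ height l ℤ.- 0ℤ
ones-zeros≡height l =
  trans (cong (λ k → k ℤ.- ℤ.+ zeros l) (sym (zeros+height≡ones l))) (difference (ℤ.+ zeros l) (height l))
  where
  difference : ∀ z h → (z ℤ.+ h) ℤ.- z ≡ h ℤ.- 0ℤ
  difference = solve-∀ ℤ-ring

zeros<ones⇒0<height : ∀ l → zeros l ℕ.< ones l → 0ℤ ℤ.< height l
zeros<ones⇒0<height l z<o = <-by-difference (ones-zeros≡height l) (ℤ.+<+ z<o)

0<height⇒zeros<ones : ∀ l → 0ℤ ℤ.< height l → zeros l ℕ.< ones l
0<height⇒zeros<ones l 0<h = ℤ.drop‿+<+ (<-by-difference (sym (ones-zeros≡height l)) 0<h)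

height-++ : ∀ l r → height (l ++ r) ≡ height l ℤ.+ height r
height-++ [] r = sym (ℤ.+-identityˡ (height r))
height-++ (c ∷ l) r = trans (cong (λ h → step c ℤ.+ h) (height-++ l r)) (sym (ℤ.+-assoc (step c) (height l) (height r)))

height-take-++ : ∀ j l r → height (take j (l ++ r)) ≡ height (take j l) ℤ.+ height (take (j ℕ.∸ length l) r)
height-take-++ zero [] r = refl
height-take-++ (suc j) [] r = sym (ℤ.+-identityˡ (height (take (suc j) r)))
height-take-++ zero (c ∷ l) r = refl
height-take-++ (suc j) (c ∷ l) r =
  trans (cong (λ h → step c ℤ.+ h) (height-take-++ j l r)) (sym (ℤ.+-assoc (step c) _ _))

height-drop : ∀ j l → height (drop j l) ≡ height l ℤ.- height (take j l)
height-drop j l = begin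
  height (drop j l)                                        ≡⟨ add-sub (height (take j l)) (height (drop j l)) ⟩
  (height (take j l) ℤ.+ height (drop j l)) ℤ.- height (take j l)
                                    ≡⟨ cong (ℤ._- height (take j l)) (height-++ (take j l) (drop j l)) ⟨
  height (take j l ++ drop j l) ℤ.- height (take j l)
                                    ≡⟨ cong (λ l′ → height l′ ℤ.- height (take j l)) (take++drop≡id j l) ⟩
  height l ℤ.- height (take j l)                           ∎
  where
  open ≡-Reasoning
  add-sub : ∀ a b → b ≡ (a ℤ.+ b) ℤ.- a
  add-sub = solve-∀ ℤ-ring

PrefixHeights : List Bool → Set
PrefixHeights l = (∀ j → 1 ℕ.≤ j → j ℕ.≤ length l → 0ℤ ℤ.< height (take j l)) ×
                  (∀ j → j ℕ.< length l → height (take j l) ℤ.< height l)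

isBBS⇒prefixHeights : ∀ l → IsBBS l → PrefixHeights l
isBBS⇒prefixHeights l (prefix , suffix) =
  (λ j 1≤j j≤l → zeros<ones⇒0<height (take j l) (prefix j 1≤j j≤l)) ,
  (λ j j<l → <-by-difference (difference (height l) (height (take j l)))
                 (subst (0ℤ ℤ.<_) (height-drop j l) (zeros<ones⇒0<height (drop j l) (suffix j j<l))))
  where
  difference : ∀ h t → h ℤ.- t ℤ.- 0ℤ ≡ h ℤ.- t
  difference = solve-∀ ℤ-ring

prefixHeights⇒isBBS : ∀ l → PrefixHeights l → IsBBS l
prefixHeights⇒isBBS l (prefix , suffix) =
  (λ j 1≤j j≤l → 0<height⇒zeros<ones (take j l) (prefix j 1≤j j≤l)) ,
  (λ j j<l → 0<height⇒zeros<ones (drop j l) (subst (0ℤ ℤ.<_) (sym (height-drop j l))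
                 (<-by-difference (difference (height l) (height (take j l))) (suffix j j<l))))
  where
  difference : ∀ h t → h ℤ.- t ≡ h ℤ.- t ℤ.- 0ℤ
  difference = solve-∀ ℤ-ring

padded : List Bool → List Bool
padded c = true ∷ true ∷ c ++ true ∷ true ∷ []

Band : List Bool → Set
Band c = ∀ t → t ℕ.≤ length c → -1ℤ ℤ.≤ height (take t c) × height (take t c) ℤ.≤ height c ℤ.+ 1ℤ

private
  2+_ : ℤ → ℤ
  2+ h = 1ℤ ℤ.+ (1ℤ ℤ.+ h)

  0<2+⇒-1≤ : ∀ h → 0ℤ ℤ.< 2+ (h ℤ.+ 0ℤ) → -1ℤ ℤ.≤ h
  0<2+⇒-1≤ h 0<2+h = ≤-by-difference (difference h) (ℤ.i<j⇒suc[i]≤j 0<2+h)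
    where
    difference : ∀ h → (1ℤ ℤ.+ (1ℤ ℤ.+ (h ℤ.+ 0ℤ))) ℤ.- (1ℤ ℤ.+ 0ℤ) ≡ h ℤ.- -1ℤ
    difference = solve-∀ ℤ-ring

  -1≤⇒0<2+ : ∀ {h e} → -1ℤ ℤ.≤ h → 0ℤ ℤ.≤ e → 0ℤ ℤ.< 2+ (h ℤ.+ e)
  -1≤⇒0<2+ {h} {e} -1≤h 0≤e = ℤ.suc[i]≤j⇒i<j (≤-by-difference (difference h e) (ℤ.+-mono-≤ -1≤h 0≤e))
    where
    difference : ∀ h e → (h ℤ.+ e) ℤ.- (-1ℤ ℤ.+ 0ℤ) ≡ (1ℤ ℤ.+ (1ℤ ℤ.+ (h ℤ.+ e))) ℤ.- (1ℤ ℤ.+ 0ℤ)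
    difference = solve-∀ ℤ-ring

  2+<2+2+⇒≤+1 : ∀ h k → 2+ (h ℤ.+ 0ℤ) ℤ.< 2+ (k ℤ.+ 2+ 0ℤ) → h ℤ.≤ k ℤ.+ 1ℤ
  2+<2+2+⇒≤+1 h k lt = ≤-by-difference (difference h k) (ℤ.i<j⇒suc[i]≤j lt)
    where
    difference : ∀ h k → (1ℤ ℤ.+ (1ℤ ℤ.+ (k ℤ.+ (1ℤ ℤ.+ (1ℤ ℤ.+ 0ℤ))))) ℤ.- (1ℤ ℤ.+ (1ℤ ℤ.+ (1ℤ ℤ.+ (h ℤ.+ 0ℤ))))
                       ≡ (k ℤ.+ 1ℤ) ℤ.- h
    difference = solve-∀ ℤ-ring

  ≤+1⇒2+<2+2+ : ∀ h k → h ℤ.≤ k ℤ.+ 1ℤ → 2+ (h ℤ.+ 0ℤ) ℤ.< 2+ (k ℤ.+ 2+ 0ℤ)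
  ≤+1⇒2+<2+2+ h k h≤k+1 = ℤ.suc[i]≤j⇒i<j (≤-by-difference (difference h k) h≤k+1)
    where
    difference : ∀ h k → (k ℤ.+ 1ℤ) ℤ.- h
                       ≡ (1ℤ ℤ.+ (1ℤ ℤ.+ (k ℤ.+ (1ℤ ℤ.+ (1ℤ ℤ.+ 0ℤ))))) ℤ.- (1ℤ ℤ.+ (1ℤ ℤ.+ (1ℤ ℤ.+ (h ℤ.+ 0ℤ))))
    difference = solve-∀ ℤ-ring

  -1≤⇒1<2+2+ : ∀ {k} → -1ℤ ℤ.≤ k → 1ℤ ℤ.+ 0ℤ ℤ.< 2+ (k ℤ.+ 2+ 0ℤ)
  -1≤⇒1<2+2+ {k} -1≤k = <-by-difference (difference k) (-1≤⇒0<2+ -1≤k (ℤ.+≤+ (ℕ.z≤n {1})))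
    where
    difference : ∀ k → (1ℤ ℤ.+ (1ℤ ℤ.+ (k ℤ.+ 1ℤ))) ℤ.- 0ℤ ≡ (1ℤ ℤ.+ (1ℤ ℤ.+ (k ℤ.+ (1ℤ ℤ.+ (1ℤ ℤ.+ 0ℤ))))) ℤ.- (1ℤ ℤ.+ 0ℤ)
    difference = solve-∀ ℤ-ring

  2+1+<2+2+ : ∀ k → 2+ (k ℤ.+ (1ℤ ℤ.+ 0ℤ)) ℤ.< 2+ (k ℤ.+ 2+ 0ℤ)
  2+1+<2+2+ k = <-by-difference (difference k) (ℤ.+<+ (ℕ.z<s {0}))
    where
    difference : ∀ k → 1ℤ ℤ.- 0ℤ ≡ (1ℤ ℤ.+ (1ℤ ℤ.+ (k ℤ.+ (1ℤ ℤ.+ (1ℤ ℤ.+ 0ℤ))))) ℤ.- (1ℤ ℤ.+ (1ℤ ℤ.+ (k ℤ.+ (1ℤ ℤ.+ 0ℤ))))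
    difference = solve-∀ ℤ-ring

module _ (c : List Bool) where
  private
    ends : List Bool
    ends = true ∷ true ∷ []

    0≤height-ends : ∀ k → 0ℤ ℤ.≤ height (take k ends)
    0≤height-ends zero = ℤ.+≤+ ℕ.z≤n
    0≤height-ends (suc zero) = ℤ.+≤+ ℕ.z≤n
    0≤height-ends (suc (suc zero)) = ℤ.+≤+ ℕ.z≤n
    0≤height-ends (suc (suc (suc k))) = ℤ.+≤+ ℕ.z≤n

  height-take-padded : ∀ t → height (take (2 ℕ.+ t) (padded c))
                             ≡ 2+ (height (take t c) ℤ.+ height (take (t ℕ.∸ length c) ends))
  height-take-padded t = cong 2+_ (height-take-++ t c ends)

  height-take-padded-inner : ∀ {t} → t ℕ.≤ length c → height (take (2 ℕ.+ t) (padded c)) ≡ 2+ (height (take t c) ℤ.+ 0ℤ)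
  height-take-padded-inner {t} t≤c =
    trans (height-take-padded t) (cong (λ k → 2+ (height (take t c) ℤ.+ height (take k ends))) (ℕ.m≤n⇒m∸n≡0 t≤c))

  height-take-padded-last : height (take (3 ℕ.+ length c) (padded c)) ≡ 2+ (height c ℤ.+ (1ℤ ℤ.+ 0ℤ))
  height-take-padded-last = trans (height-take-padded (suc (length c)))
    (cong₂ (λ l k → 2+ (height l ℤ.+ height (take k ends))) (take-all _ c (ℕ.n≤1+n _)) (ℕ.m+n∸n≡m 1 (length c)))

  height-padded : height (padded c) ≡ 2+ (height c ℤ.+ 2+ 0ℤ)
  height-padded = cong 2+_ (height-++ c ends)

  length-padded : length (padded c) ≡ 2 ℕ.+ (length c ℕ.+ 2)
  length-padded = cong (λ n → 2 ℕ.+ n) (length-++ c)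

  band⇒-1≤height-take : Band c → ∀ t → -1ℤ ℤ.≤ height (take t c)
  band⇒-1≤height-take band t with t ℕ.≤? length c
  ... | yes t≤c = proj₁ (band t t≤c)
  ... | no t≰c = subst (λ l → -1ℤ ℤ.≤ height l) (trans (take-all (length c) c ℕ.≤-refl) (sym (take-all t c c≤t)))
                   (proj₁ (band (length c) ℕ.≤-refl))
    where
    c≤t = ℕ.<⇒≤ (ℕ.≰⇒> t≰c)

  padded-isBBS⇒band : IsBBS (padded c) → Band c
  padded-isBBS⇒band bbs t t≤c =
    0<2+⇒-1≤ (height (take t c))
      (subst (0ℤ ℤ.<_) (height-take-padded-inner t≤c) (proj₁ heights (2 ℕ.+ t) (ℕ.s≤s ℕ.z≤n) (ℕ.<⇒≤ 2+t<len))) ,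
    2+<2+2+⇒≤+1 (height (take t c)) (height c)
      (subst₂ ℤ._<_ (height-take-padded-inner t≤c) height-padded (proj₂ heights (2 ℕ.+ t) 2+t<len))
    where
    heights = isBBS⇒prefixHeights (padded c) bbs
    2+t<len : 2 ℕ.+ t ℕ.< length (padded c)
    2+t<len = subst (2 ℕ.+ t ℕ.<_) (sym length-padded)
      (ℕ.s≤s (ℕ.s≤s (ℕ.≤-trans (ℕ.s≤s t≤c) (subst (suc (length c) ℕ.≤_) (ℕ.+-comm 2 (length c)) (ℕ.n≤1+n _)))))

  band⇒padded-isBBS : Band c → IsBBS (padded c)
  band⇒padded-isBBS band = prefixHeights⇒isBBS (padded c) (prefix , suffix)
    where
    -1≤height : -1ℤ ℤ.≤ height c
    -1≤height = subst (λ l → -1ℤ ℤ.≤ height l) (take-all (length c) c ℕ.≤-refl) (band⇒-1≤height-take band (length c))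
    prefix : ∀ j → 1 ℕ.≤ j → j ℕ.≤ length (padded c) → 0ℤ ℤ.< height (take j (padded c))
    prefix (suc zero) _ _ = ℤ.+<+ ℕ.z<s
    prefix (suc (suc t)) _ _ = subst (0ℤ ℤ.<_) (sym (height-take-padded t))
                                 (-1≤⇒0<2+ (band⇒-1≤height-take band t) (0≤height-ends (t ℕ.∸ length c)))
    last : ∀ {t} → t ≡ suc (length c) → height (take (2 ℕ.+ t) (padded c)) ℤ.< height (padded c)
    last refl = subst₂ ℤ._<_ (sym height-take-padded-last) (sym height-padded) (2+1+<2+2+ (height c))
    suffix : ∀ j → j ℕ.< length (padded c) → height (take j (padded c)) ℤ.< height (padded c)
    suffix zero _ = subst (0ℤ ℤ.<_) (sym height-padded) (-1≤⇒0<2+ -1≤height (0≤height-ends 2))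
    suffix (suc zero) _ = subst (1ℤ ℤ.+ 0ℤ ℤ.<_) (sym height-padded) (-1≤⇒1<2+2+ -1≤height)
    suffix (suc (suc t)) 2+t<len with t ℕ.≤? length c
    ... | yes t≤c = subst₂ ℤ._<_ (sym (height-take-padded-inner t≤c)) (sym height-padded)
                      (≤+1⇒2+<2+2+ (height (take t c)) (height c) (proj₂ (band t t≤c)))
    ... | no t≰c = last (ℕ.≤-antisym t≤1+c (ℕ.≰⇒> t≰c))
      where
      t≤1+c : t ℕ.≤ suc (length c)
      t≤1+c = ℕ.≤-pred (subst (suc t ℕ.≤_) (ℕ.+-comm (length c) 2)
                (ℕ.≤-pred (ℕ.≤-pred (subst (suc (suc (suc t)) ℕ.≤_) length-padded 2+t<len))))

pathℤ : ∀ {m} → Vec Bool m → ℕ → ℤ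
pathℤ [] t = 0ℤ
pathℤ (a ∷ b) zero = 0ℤ
pathℤ (a ∷ b) (suc t) = bitℤ a ℤ.- pathℤ b t

path-binary : ∀ {m} (b : Vec Bool m) t → path (binary b) t ≡ fromℤ (pathℤ b t)
path-binary [] t = refl
path-binary (a ∷ b) zero = refl
path-binary (a ∷ b) (suc t) = trans (cong (λ p → bit a - p) (path-binary b t)) (sym (fromℤ-minus (bitℤ a) (pathℤ b t)))

BallotPathℤ : (ℕ → ℤ) → ℕ → Set
BallotPathℤ P m = ∀ t → t ℕ.≤ m → 0ℤ ℤ.≤ P t × P t ℤ.≤ P m

binary-box : ∀ {m} (b : Vec Bool m) → Box (binary b)
binary-box (true ∷ b) zero _ = *≤* (ℤ.+≤+ ℕ.z≤n) , ≤-refl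
binary-box (false ∷ b) zero _ = ≤-refl , *≤* (ℤ.+≤+ ℕ.z≤n)
binary-box (a ∷ b) (suc t) (ℕ.s<s t<m) = binary-box b t t<m

module _ (n' : ℕ) (b : Vec Bool (dim (suc n'))) where
  private
    m = dim (suc n')

  binary-inPolytope⇒ballotPathℤ : InPolytope (suc n') (binary b) → BallotPathℤ (pathℤ b) m
  binary-inPolytope⇒ballotPathℤ ip t t≤m =
    Product.map fromℤ-cancel-≤ fromℤ-cancel-≤
      (subst₂ (λ p q → 0ℚ ≤ℚ p × p ≤ℚ q) (path-binary b t) (path-binary b m) (inPolytope⇒ballotPath n' (binary b) ip t t≤m))

  ballotPathℤ⇒binary-inPolytope : BallotPathℤ (pathℤ b) m → InPolytope (suc n') (binary b)
  ballotPathℤ⇒binary-inPolytope ballot = ballotPath⇒inPolytope n' (binary b) (binary-box b) λ t t≤m →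
    subst₂ (λ p q → 0ℚ ≤ℚ p × p ≤ℚ q) (sym (path-binary b t)) (sym (path-binary b m))
      (Product.map fromℤ-mono-≤ fromℤ-mono-≤ (ballot t t≤m))

mapWithIndex : ∀ {A B : Set} {k} → (ℕ → A → B) → Vec A k → Vec B k
mapWithIndex f [] = []
mapWithIndex f (x ∷ xs) = f 0 x ∷ mapWithIndex (λ i → f (suc i)) xs

module _ {A B : Set} where

  tabulate-lookup≡mapWithIndex : ∀ {k} (f : ℕ → A → B) (xs : Vec A k) →
                                 tabulate (λ j → f (toℕ j) (lookup xs j)) ≡ mapWithIndex f xs
  tabulate-lookup≡mapWithIndex f [] = refl
  tabulate-lookup≡mapWithIndex f (x ∷ xs) = cong (f 0 x ∷_) (tabulate-lookup≡mapWithIndex (λ i → f (suc i)) xs)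

  mapWithIndex-∷ʳ : ∀ {k} (f : ℕ → A → B) (xs : Vec A k) x → mapWithIndex f (xs ∷ʳ x) ≡ mapWithIndex f xs ∷ʳ f k x
  mapWithIndex-∷ʳ f [] x = refl
  mapWithIndex-∷ʳ f (y ∷ xs) x = cong (f 0 y ∷_) (mapWithIndex-∷ʳ (λ i → f (suc i)) xs x)

module _ {A B C : Set} where

  map-mapWithIndex : ∀ {k} {f : B → C} {g : ℕ → A → B} {h : ℕ → A → C} → (∀ i x → f (g i x) ≡ h i x) →
                     (xs : Vec A k) → Vec.map f (mapWithIndex g xs) ≡ mapWithIndex h xs
  map-mapWithIndex fg≗h [] = refl
  map-mapWithIndex fg≗h (x ∷ xs) = cong₂ _∷_ (fg≗h 0 x) (map-mapWithIndex (λ i → fg≗h (suc i)) xs)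

  mapWithIndex-map : ∀ {k} (f : ℕ → B → C) (g : A → B) (xs : Vec A k) →
                     mapWithIndex f (Vec.map g xs) ≡ mapWithIndex (λ i x → f i (g x)) xs
  mapWithIndex-map f g [] = refl
  mapWithIndex-map f g (x ∷ xs) = cong (f 0 (g x) ∷_) (mapWithIndex-map (λ i → f (suc i)) g xs)

mapWithIndex-inverse : ∀ {A : Set} {k} {f g : ℕ → A → A} → (∀ i x → f i (g i x) ≡ x) →
                       (xs : Vec A k) → mapWithIndex f (mapWithIndex g xs) ≡ xs
mapWithIndex-inverse fg≗id [] = refl
mapWithIndex-inverse fg≗id (x ∷ xs) = cong₂ _∷_ (fg≗id 0 x) (mapWithIndex-inverse (λ i → fg≗id (suc i)) xs)

flipOdd : ℕ → Bool → Bool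
flipOdd i c = if isEven i then c else not c

flipOdd-involutive : ∀ i c → flipOdd i (flipOdd i c) ≡ c
flipOdd-involutive i c with isEven i
... | true = refl
... | false = not-involutive c

alternate : ∀ {k} → Vec Bool k → Vec Bool k
alternate = mapWithIndex flipOdd

alternate-involutive : ∀ {k} (b : Vec Bool k) → alternate (alternate b) ≡ b
alternate-involutive = mapWithIndex-inverse flipOdd-involutive

alternate-∷ : ∀ {k} a (b : Vec Bool k) → alternate (a ∷ b) ≡ a ∷ Vec.map not (alternate b)
alternate-∷ a b = cong (a ∷_) (sym (map-mapWithIndex not-flipOdd b))
  where
  not-flipOdd : ∀ i c → not (flipOdd i c) ≡ flipOdd (suc i) c
  not-flipOdd i c with isEven i
  ... | true = refl
  ... | false = not-involutive c

height-map-not : ∀ l → height (List.map not l) ≡ ℤ.- height l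
height-map-not [] = refl
height-map-not (c ∷ l) = trans (cong (λ h → step (not c) ℤ.+ h) (height-map-not l)) (negate c (height l))
  where
  negate : ∀ c h → step (not c) ℤ.+ ℤ.- h ≡ ℤ.- (step c ℤ.+ h)
  negate true h = sym (ℤ.neg-distrib-+ 1ℤ h)
  negate false h = sym (ℤ.neg-distrib-+ -1ℤ h)

parityℤ : ℕ → ℤ
parityℤ t = if isEven t then 0ℤ else 1ℤ

height-alternate : ∀ {m} (b : Vec Bool m) t → t ℕ.≤ m →
                   height (take t (toList (alternate b))) ≡ (pathℤ b t ℤ.+ pathℤ b t) ℤ.- parityℤ t
height-alternate [] zero _ = refl
height-alternate (a ∷ b) zero _ = refl
height-alternate (a ∷ b) (suc t) (ℕ.s≤s t≤m) = begin
  height (take (suc t) (toList (alternate (a ∷ b))))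
    ≡⟨ cong (λ v → height (take (suc t) (toList v))) (alternate-∷ a b) ⟩
  step a ℤ.+ height (take t (toList (Vec.map not (alternate b))))
    ≡⟨ cong (λ l → step a ℤ.+ height (take t l)) (toList-map not (alternate b)) ⟩
  step a ℤ.+ height (take t (List.map not (toList (alternate b))))
    ≡⟨ cong (λ l → step a ℤ.+ height l) (take-map t (toList (alternate b))) ⟩
  step a ℤ.+ height (List.map not (take t (toList (alternate b))))
    ≡⟨ cong (λ h → step a ℤ.+ h) (height-map-not (take t (toList (alternate b)))) ⟩
  step a ℤ.+ ℤ.- height (take t (toList (alternate b)))
    ≡⟨ cong₂ (λ s h → s ℤ.+ ℤ.- h) (step≡ a) (height-alternate b t t≤m) ⟩
  ((bitℤ a ℤ.+ bitℤ a) ℤ.- 1ℤ) ℤ.+ ℤ.- ((pathℤ b t ℤ.+ pathℤ b t) ℤ.- parityℤ t)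
    ≡⟨ regroup (bitℤ a) (pathℤ b t) (parityℤ t) ⟩
  ((bitℤ a ℤ.- pathℤ b t) ℤ.+ (bitℤ a ℤ.- pathℤ b t)) ℤ.- (1ℤ ℤ.- parityℤ t)
    ≡⟨ cong (λ p → ((bitℤ a ℤ.- pathℤ b t) ℤ.+ (bitℤ a ℤ.- pathℤ b t)) ℤ.- p) (parityℤ-suc t) ⟨
  (pathℤ (a ∷ b) (suc t) ℤ.+ pathℤ (a ∷ b) (suc t)) ℤ.- parityℤ (suc t) ∎
  where
  open ≡-Reasoning
  step≡ : ∀ c → step c ≡ (bitℤ c ℤ.+ bitℤ c) ℤ.- 1ℤ
  step≡ true = refl
  step≡ false = refl
  parityℤ-suc : ∀ t → parityℤ (suc t) ≡ 1ℤ ℤ.- parityℤ t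
  parityℤ-suc t with isEven t
  ... | true = refl
  ... | false = refl
  regroup : ∀ β s o → ((β ℤ.+ β) ℤ.- 1ℤ) ℤ.+ ℤ.- ((s ℤ.+ s) ℤ.- o) ≡ ((β ℤ.- s) ℤ.+ (β ℤ.- s)) ℤ.- (1ℤ ℤ.- o)
  regroup = solve-∀ ℤ-ring

-1≤d+d⇒0≤d : ∀ d → -1ℤ ℤ.≤ d ℤ.+ d → 0ℤ ℤ.≤ d
-1≤d+d⇒0≤d (ℤ.+ n) _ = ℤ.+≤+ ℕ.z≤n
-1≤d+d⇒0≤d ℤ.-[1+ n ] (ℤ.-≤- ())

module _ {o : ℤ} (0≤o : 0ℤ ℤ.≤ o) (o≤1 : o ℤ.≤ 1ℤ) where

  -1≤2s-o⇒0≤s : ∀ {s} → -1ℤ ℤ.≤ (s ℤ.+ s) ℤ.- o → 0ℤ ℤ.≤ s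
  -1≤2s-o⇒0≤s {s} -1≤2s-o = -1≤d+d⇒0≤d s (ℤ.≤-trans -1≤2s-o (≤-by-difference (difference s o) 0≤o))
    where
    difference : ∀ s o → o ℤ.- 0ℤ ≡ (s ℤ.+ s) ℤ.- ((s ℤ.+ s) ℤ.- o)
    difference = solve-∀ ℤ-ring

  0≤s⇒-1≤2s-o : ∀ {s} → 0ℤ ℤ.≤ s → -1ℤ ℤ.≤ (s ℤ.+ s) ℤ.- o
  0≤s⇒-1≤2s-o {s} 0≤s = ≤-by-difference (difference s o) (ℤ.+-mono-≤ (ℤ.+-mono-≤ 0≤s 0≤s) (ℤ.i≤j⇒0≤j-i o≤1))
    where
    difference : ∀ s o → ((s ℤ.+ s) ℤ.+ (1ℤ ℤ.- o)) ℤ.- ((0ℤ ℤ.+ 0ℤ) ℤ.+ 0ℤ) ≡ ((s ℤ.+ s) ℤ.- o) ℤ.- -1ℤ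
    difference = solve-∀ ℤ-ring

  2s-o≤2S⇒s≤S : ∀ {s S} → (s ℤ.+ s) ℤ.- o ℤ.≤ ((S ℤ.+ S) ℤ.- 1ℤ) ℤ.+ 1ℤ → s ℤ.≤ S
  2s-o≤2S⇒s≤S {s} {S} 2s-o≤2S = ℤ.0≤i-j⇒j≤i (-1≤d+d⇒0≤d (S ℤ.- s)
    (≤-by-difference (difference s S o) (ℤ.+-mono-≤ (ℤ.i≤j⇒0≤j-i 2s-o≤2S) (ℤ.i≤j⇒0≤j-i o≤1))))
    where
    difference : ∀ s S o → ((((S ℤ.+ S) ℤ.- 1ℤ) ℤ.+ 1ℤ) ℤ.- ((s ℤ.+ s) ℤ.- o) ℤ.+ (1ℤ ℤ.- o)) ℤ.- (0ℤ ℤ.+ 0ℤ)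
                       ≡ ((S ℤ.- s) ℤ.+ (S ℤ.- s)) ℤ.- -1ℤ
    difference = solve-∀ ℤ-ring

  s≤S⇒2s-o≤2S : ∀ {s S} → s ℤ.≤ S → (s ℤ.+ s) ℤ.- o ℤ.≤ ((S ℤ.+ S) ℤ.- 1ℤ) ℤ.+ 1ℤ
  s≤S⇒2s-o≤2S {s} {S} s≤S = ≤-by-difference (difference s S o)
    (ℤ.+-mono-≤ (ℤ.+-mono-≤ (ℤ.i≤j⇒0≤j-i s≤S) (ℤ.i≤j⇒0≤j-i s≤S)) 0≤o)
    where
    difference : ∀ s S o → ((S ℤ.- s) ℤ.+ (S ℤ.- s) ℤ.+ o) ℤ.- ((0ℤ ℤ.+ 0ℤ) ℤ.+ 0ℤ)
                       ≡ (((S ℤ.+ S) ℤ.- 1ℤ) ℤ.+ 1ℤ) ℤ.- ((s ℤ.+ s) ℤ.- o)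
    difference = solve-∀ ℤ-ring

parityℤ-bounds : ∀ t → 0ℤ ℤ.≤ parityℤ t × parityℤ t ℤ.≤ 1ℤ
parityℤ-bounds t with isEven t
... | true = ℤ.+≤+ ℕ.z≤n , ℤ.+≤+ ℕ.z≤n
... | false = ℤ.+≤+ ℕ.z≤n , ℤ.≤-refl

module _ {m} (b : Vec Bool m) (m-odd : isEven m ≡ false) where
  private
    c = toList (alternate b)
    length-c : length c ≡ m
    length-c = length-toList (alternate b)

  height-alternate-all : height c ≡ (pathℤ b m ℤ.+ pathℤ b m) ℤ.- 1ℤ
  height-alternate-all = begin
    height c                                        ≡⟨ cong height (take-all m c (ℕ.≤-reflexive length-c)) ⟨
    height (take m c)                               ≡⟨ height-alternate b m ℕ.≤-refl ⟩
    (pathℤ b m ℤ.+ pathℤ b m) ℤ.- parityℤ m         ≡⟨ cong (λ o → (pathℤ b m ℤ.+ pathℤ b m) ℤ.- o) parity-m ⟩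
    (pathℤ b m ℤ.+ pathℤ b m) ℤ.- 1ℤ                ∎
    where
    open ≡-Reasoning
    parity-m : parityℤ m ≡ 1ℤ
    parity-m rewrite m-odd = refl

  band⇒ballotPathℤ : Band c → BallotPathℤ (pathℤ b) m
  band⇒ballotPathℤ band t t≤m =
    -1≤2s-o⇒0≤s 0≤o o≤1 (subst (-1ℤ ℤ.≤_) (height-alternate b t t≤m) (proj₁ (band t t≤c))) ,
    2s-o≤2S⇒s≤S 0≤o o≤1 (subst₂ ℤ._≤_ (height-alternate b t t≤m) (cong (ℤ._+ 1ℤ) height-alternate-all) (proj₂ (band t t≤c)))
    where
    t≤c = subst (t ℕ.≤_) (sym length-c) t≤m
    0≤o = proj₁ (parityℤ-bounds t)
    o≤1 = proj₂ (parityℤ-bounds t)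

  ballotPathℤ⇒band : BallotPathℤ (pathℤ b) m → Band c
  ballotPathℤ⇒band ballot t t≤c =
    subst (-1ℤ ℤ.≤_) (sym (height-alternate b t t≤m)) (0≤s⇒-1≤2s-o 0≤o o≤1 (proj₁ (ballot t t≤m))) ,
    subst₂ ℤ._≤_ (sym (height-alternate b t t≤m)) (cong (ℤ._+ 1ℤ) (sym height-alternate-all))
      (s≤S⇒2s-o≤2S 0≤o o≤1 (proj₂ (ballot t t≤m)))
    where
    t≤m = subst (t ℕ.≤_) length-c t≤c
    0≤o = proj₁ (parityℤ-bounds t)
    o≤1 = proj₂ (parityℤ-bounds t)

encode : ∀ {m} → Vec Bool m → Vec Bool (4 ℕ.+ m)
encode b = true ∷ true ∷ ((alternate b ∷ʳ true) ∷ʳ true)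

toList-∷ʳ-∷ʳ : ∀ {A : Set} {k} (xs : Vec A k) x y → toList ((xs ∷ʳ x) ∷ʳ y) ≡ toList xs ++ x ∷ y ∷ []
toList-∷ʳ-∷ʳ xs x y = begin
  toList ((xs ∷ʳ x) ∷ʳ y)              ≡⟨ toList-∷ʳ y (xs ∷ʳ x) ⟩
  toList (xs ∷ʳ x) ++ y ∷ []           ≡⟨ cong (_++ y ∷ []) (toList-∷ʳ x xs) ⟩
  (toList xs ++ x ∷ []) ++ y ∷ []      ≡⟨ ++-assoc (toList xs) (x ∷ []) (y ∷ []) ⟩
  toList xs ++ x ∷ y ∷ []              ∎
  where open ≡-Reasoning

toList-encode : ∀ {m} (b : Vec Bool m) → toList (encode b) ≡ padded (toList (alternate b))
toList-encode b = cong (λ l → true ∷ true ∷ l) (toList-∷ʳ-∷ʳ (alternate b) true true)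

encode-injective : ∀ {m} (b b′ : Vec Bool m) → encode b ≡ encode b′ → b ≡ b′
encode-injective b b′ eq = begin
  b                          ≡⟨ alternate-involutive b ⟨
  alternate (alternate b)    ≡⟨ cong alternate alternate-b≡alternate-b′ ⟩
  alternate (alternate b′)   ≡⟨ alternate-involutive b′ ⟩
  b′                         ∎
  where
  open ≡-Reasoning
  alternate-b≡alternate-b′ : alternate b ≡ alternate b′
  alternate-b≡alternate-b′ = ∷ʳ-injectiveˡ _ _ (∷ʳ-injectiveˡ _ _ (∷-injectiveʳ (∷-injectiveʳ eq)))

alpha-∷ʳ : ∀ {m} (v : Vec ℚ m) → alpha v ≡ 1ℚ ∷ 0ℚ ∷ ((v ∷ʳ 0ℚ) ∷ʳ 1ℚ)
alpha-∷ʳ v = cong (λ w → 1ℚ ∷ 0ℚ ∷ w) (cast-++-pair _ v)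
  where
  cast-++-pair : ∀ {A : Set} {k} .(eq : k ℕ.+ 2 ≡ suc (suc k)) (xs : Vec A k) {a a′} →
                 Vec.cast eq (xs Vec.++ (a ∷ a′ ∷ [])) ≡ (xs ∷ʳ a) ∷ʳ a′
  cast-++-pair eq [] = refl
  cast-++-pair eq (x ∷ xs) = cong (x ∷_) (cast-++-pair _ xs)

private
  λ-entry : ℕ → ℚ → ℚ
  λ-entry j a = sgn j * ((1ℚ + 1ℚ) * a - 1ℚ)

  isOne : ℚ → Bool
  isOne l = does (l ≟ 1ℚ)

  isOne-λ-entry-bit : ∀ i c → isOne (λ-entry (2 ℕ.+ i) (bit c)) ≡ flipOdd i c
  isOne-λ-entry-bit i c with isEven i | c
  ... | true | true = refl
  ... | true | false = refl
  ... | false | true = refl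
  ... | false | false = refl

  isOne-λ-entry-ends : ∀ {m} → isEven m ≡ false → isOne (λ-entry (2 ℕ.+ m) 0ℚ) ≡ true × isOne (λ-entry (3 ℕ.+ m) 1ℚ) ≡ true
  isOne-λ-entry-ends {m} m-odd with isEven m | m-odd
  ... | .false | refl = refl , refl

bseq-binary : ∀ {m} (b : Vec Bool m) → isEven m ≡ false → bseq (binary b) ≡ encode b
bseq-binary {m} b m-odd = begin
  bseq (binary b)
    ≡⟨ cong (Vec.map isOne) (tabulate-lookup≡mapWithIndex λ-entry (alpha (binary b))) ⟩
  Vec.map isOne (mapWithIndex λ-entry (alpha (binary b)))
    ≡⟨ cong (λ α → Vec.map isOne (mapWithIndex λ-entry α)) (alpha-∷ʳ (binary b)) ⟩
  true ∷ true ∷ Vec.map isOne (mapWithIndex λ₂ ((binary b ∷ʳ 0ℚ) ∷ʳ 1ℚ))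
    ≡⟨ cong (λ v → true ∷ true ∷ Vec.map isOne v)
         (trans (mapWithIndex-∷ʳ λ₂ (binary b ∷ʳ 0ℚ) 1ℚ) (cong (_∷ʳ λ₂ (suc m) 1ℚ) (mapWithIndex-∷ʳ λ₂ (binary b) 0ℚ))) ⟩
  true ∷ true ∷ Vec.map isOne ((mapWithIndex λ₂ (binary b) ∷ʳ λ₂ m 0ℚ) ∷ʳ λ₂ (suc m) 1ℚ)
    ≡⟨ cong (λ v → true ∷ true ∷ v) (trans (map-∷ʳ isOne _ _) (cong (_∷ʳ _) (map-∷ʳ isOne _ _))) ⟩
  true ∷ true ∷ ((Vec.map isOne (mapWithIndex λ₂ (binary b)) ∷ʳ isOne (λ₂ m 0ℚ)) ∷ʳ isOne (λ₂ (suc m) 1ℚ))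
    ≡⟨ cong (λ v → true ∷ true ∷ ((v ∷ʳ isOne (λ₂ m 0ℚ)) ∷ʳ isOne (λ₂ (suc m) 1ℚ))) middle ⟩
  true ∷ true ∷ ((alternate b ∷ʳ isOne (λ₂ m 0ℚ)) ∷ʳ isOne (λ₂ (suc m) 1ℚ))
    ≡⟨ cong₂ (λ e e′ → true ∷ true ∷ ((alternate b ∷ʳ e) ∷ʳ e′)) (proj₁ ends) (proj₂ ends) ⟩
  encode b ∎
  where
  open ≡-Reasoning
  λ₂ : ℕ → ℚ → ℚ
  λ₂ i = λ-entry (2 ℕ.+ i)
  middle : Vec.map isOne (mapWithIndex λ₂ (binary b)) ≡ alternate b
  middle = trans (cong (Vec.map isOne) (mapWithIndex-map λ₂ bit b)) (map-mapWithIndex isOne-λ-entry-bit b)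
  ends = isOne-λ-entry-ends {m} m-odd

drop-length-++ : ∀ {A : Set} (l r : List A) → drop (length l) (l ++ r) ≡ r
drop-length-++ [] r = refl
drop-length-++ (x ∷ l) r = drop-length-++ l r

both-true : ∀ x y → zeros (x ∷ y ∷ []) ℕ.< ones (x ∷ y ∷ []) → x ≡ true × y ≡ true
both-true true true _ = refl , refl
both-true true false (ℕ.s≤s ())
both-true false true (ℕ.s≤s ())
both-true false false ()

isBBS-ends : ∀ {a a′ e e′} l → IsBBS (a ∷ a′ ∷ l ++ e ∷ e′ ∷ []) → (a ≡ true × a′ ≡ true) × (e ≡ true × e′ ≡ true)
isBBS-ends {a} {a′} {e} {e′} l (prefix , suffix) =
  both-true a a′ (prefix 2 (ℕ.s≤s ℕ.z≤n) (ℕ.s≤s (ℕ.s≤s ℕ.z≤n))) ,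
  both-true e e′ (subst (λ r → zeros r ℕ.< ones r) (drop-length-++ l (e ∷ e′ ∷ [])) (suffix (2 ℕ.+ length l) 2+l<len))
  where
  2+l<len : 2 ℕ.+ length l ℕ.< length (a ∷ a′ ∷ l ++ e ∷ e′ ∷ [])
  2+l<len = ℕ.s≤s (ℕ.s≤s (subst (suc (length l) ℕ.≤_) (sym (length-++ l))
              (subst (suc (length l) ℕ.≤_) (ℕ.+-comm 2 (length l)) (ℕ.n≤1+n _))))

isBBS⇒encoded : ∀ {m} (s : Vec Bool (4 ℕ.+ m)) → IsBBS (toList s) → ∃ λ b → encode b ≡ s
isBBS⇒encoded (a ∷ a′ ∷ s″) bbs with Vec.initLast s″
... | ys , e′ , refl with Vec.initLast ys
... | c , e , refl with isBBS-ends (toList c) (subst (λ l → IsBBS (a ∷ a′ ∷ l)) (toList-∷ʳ-∷ʳ c e e′) bbs)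
... | (refl , refl) , (refl , refl) = alternate c , cong (λ v → true ∷ true ∷ ((v ∷ʳ true) ∷ʳ true)) (alternate-involutive c)

module _ (n' : ℕ) where
  private
    m = dim (suc n')
    m-odd : isEven m ≡ false
    m-odd = trans (cong isEven (dim-suc n')) (isEven-odd n')

  toList-bseq-binary : ∀ (b : Vec Bool m) → toList (bseq (binary b)) ≡ padded (toList (alternate b))
  toList-bseq-binary b = trans (cong toList (bseq-binary b m-odd)) (toList-encode b)

  binary-inPolytope⇒isBBS : ∀ (b : Vec Bool m) → InPolytope (suc n') (binary b) → IsBBS (toList (bseq (binary b)))
  binary-inPolytope⇒isBBS b ip = subst IsBBS (sym (toList-bseq-binary b))
    (band⇒padded-isBBS _ (ballotPathℤ⇒band b m-odd (binary-inPolytope⇒ballotPathℤ n' b ip)))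

  isBBS⇒binary-inPolytope : ∀ (b : Vec Bool m) → IsBBS (toList (bseq (binary b))) → InPolytope (suc n') (binary b)
  isBBS⇒binary-inPolytope b bbs = ballotPathℤ⇒binary-inPolytope n' b
    (band⇒ballotPathℤ b m-odd (padded-isBBS⇒band _ (subst IsBBS (toList-bseq-binary b) bbs)))

  vertex⇒isBBS : ∀ v → IsVertex (suc n') v → IsBBS (toList (bseq v))
  vertex⇒isBBS v vertex = subst (λ x → IsBBS (toList (bseq x))) (sym v≡b)
    (binary-inPolytope⇒isBBS b (subst (InPolytope (suc n')) v≡b (proj₁ vertex)))
    where
    b = proj₁ (vertex⇒binary-point n' v vertex)
    v≡b = proj₂ (vertex⇒binary-point n' v vertex)

  bseq-injective-on-vertices : ∀ v w → IsVertex (suc n') v → IsVertex (suc n') w → bseq v ≡ bseq w → v ≡ w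
  bseq-injective-on-vertices v w v-vertex w-vertex eq = begin
    v            ≡⟨ v≡b ⟩
    binary b     ≡⟨ cong binary (encode-injective b b′ encodings≡) ⟩
    binary b′    ≡⟨ w≡b′ ⟨
    w            ∎
    where
    open ≡-Reasoning
    b = proj₁ (vertex⇒binary-point n' v v-vertex)
    v≡b = proj₂ (vertex⇒binary-point n' v v-vertex)
    b′ = proj₁ (vertex⇒binary-point n' w w-vertex)
    w≡b′ = proj₂ (vertex⇒binary-point n' w w-vertex)
    encodings≡ : encode b ≡ encode b′
    encodings≡ = begin
      encode b            ≡⟨ bseq-binary b m-odd ⟨
      bseq (binary b)     ≡⟨ cong bseq v≡b ⟨
      bseq v              ≡⟨ eq ⟩
      bseq w              ≡⟨ cong bseq w≡b′ ⟩
      bseq (binary b′)    ≡⟨ bseq-binary b′ m-odd ⟩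
      encode b′           ∎

  isBBS⇒vertex : ∀ s → IsBBS (toList s) → ∃ λ v → IsVertex (suc n') v × bseq v ≡ s
  isBBS⇒vertex s bbs = binary b , binary⇒vertex (suc n') b ip , bseq≡s
    where
    b = proj₁ (isBBS⇒encoded s bbs)
    bseq≡s : bseq (binary b) ≡ s
    bseq≡s = trans (bseq-binary b m-odd) (proj₂ (isBBS⇒encoded s bbs))
    ip = isBBS⇒binary-inPolytope b (subst (λ s → IsBBS (toList s)) (sym bseq≡s) bbs)

theorem4p5 : (n : ℕ) → 1 ≤ n →
    ((v : Vec ℚ (dim n)) → IsVertex n v → IsBBS (toList (bseq v))) ×
    ((v w : Vec ℚ (dim n)) → IsVertex n v → IsVertex n w → bseq v ≡ bseq w → v ≡ w) ×
    ((s : Vec Bool (4 Data.Nat.+ dim n)) → IsBBS (toList s) →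
      ∃ λ (v : Vec ℚ (dim n)) → IsVertex n v × bseq v ≡ s)
theorem4p5 (suc n') _ = vertex⇒isBBS n' , bseq-injective-on-vertices n' , isBBS⇒vertex n'
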